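{- For $k\geq 0$ let $R_k(x)=\sum_{n\geq k}\frac{p_{n;\leq n-k}}{n!}x^n$. Then $R_0(x)=P(x)$, $R_1(x)=(1-x)P(x)-1$, and for every $k\geq 1$ $$R_{k+1}(x)=R_k(x)-\sum_{i=1}^{k+1}\frac{x^i}{i!}R_{k+1-i}(x).$$ Furthermore, for every $k\geq 0$, $$R_k(x)=P(x)\sum_{i=0}^{k}\frac{(-1)^i(k+1-i)^i}{i!}x^i-\sum_{i=0}^{k-1}\frac{(-1)^i(k-i)^i}{i!}x^i.$$
   Context: There are $n$ parking spaces in a line numbered $1,\dots,n$; $n$ cars arrive in order, car $j$ has preference $a_j\in[n]$ and parks in the first unoccupied space numbered $\geq a_j$, if any; $(a_1,\dots,a_n)$ is a parking function if all cars park. For $1\le s\le n$, $p_{n;\leq s}$ is the number of parking functions of length $n$ with all $a_j\leq s$; by convention $p_{0;\leq 0}=1$ and $p_{n;\leq 0}=0$ for $n>0$. $P(x)=\sum_{n\geq 0}\frac{(n+1)^{n-1}}{n!}x^n$. -}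

module Defs where

open import Data.Bool using (Bool; true; false; if_then_else_)
open import Data.Maybe using (Maybe; just; nothing)
import Data.Maybe as Maybe
open import Data.List using (List; []; _∷_; replicate; map; concatMap; applyUpTo; foldr)
open import Data.Nat using (ℕ; zero; suc; _∸_; _!; _≤ᵇ_; _≡ᵇ_)
import Data.Nat as ℕ
open import Data.Nat.Properties using (_!≢0)
open import Data.Integer using (ℤ; +_; -[1+_])
import Data.Integer as ℤ
open import Data.Rational using (ℚ; 0ℚ; 1ℚ; _/_; _+_; _-_; _*_)

-- The occupancy state of spaces 1..n is a list of n booleans
-- (true = occupied).  'parkAt a st' parks a car with preference a in
-- the first unoccupied space numbered ≥ a, returning nothing if there
-- is no such space.  (The head of the list is space number 1.)

parkAt : ℕ → List Bool → Maybe (List Bool)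
parkAt _ [] = nothing
parkAt (suc (suc a)) (b ∷ bs) = Maybe.map (b ∷_) (parkAt (suc a) bs)
parkAt _ (false ∷ bs) = just (true ∷ bs)
parkAt _ (true ∷ bs) = Maybe.map (true ∷_) (parkAt 1 bs)

allPark : List ℕ → List Bool → Bool
allPark [] st = true
allPark (a ∷ as) st with parkAt a st
... | nothing  = false
... | just st' = allPark as st'

isParkingFunction : (n : ℕ) → List ℕ → Bool
isParkingFunction n as = allPark as (replicate n false)

seqs : ℕ → ℕ → List (List ℕ)
seqs zero    s = [] ∷ []
seqs (suc n) s = concatMap (λ a → map (a ∷_) (seqs n s)) (applyUpTo suc s)

countTrue : ∀ {A : Set} → (A → Bool) → List A → ℕ
countTrue p [] = 0
countTrue p (x ∷ xs) = if p x then suc (countTrue p xs) else countTrue p xs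

-- p_{n;≤s}: number of parking functions of length n with all a_j ≤ s
-- (gives p_{0;≤0} = 1 and p_{n;≤0} = 0 for n > 0 automatically)
pLe : ℕ → ℕ → ℕ
pLe n s = countTrue (isParkingFunction n) (seqs n s)

Series : Set
Series = ℕ → ℚ

_/!_ : ℤ → ℕ → ℚ
z /! n = (z / (n !)) {{n !≢0}}

sumℚ : List ℚ → ℚ
sumℚ = foldr _+_ 0ℚ

-- indices a, a+1, …, b-1  (empty if b ≤ a)
range : ℕ → ℕ → List ℕ
range a b = applyUpTo (a ℕ.+_) (b ∸ a)

_⊕_ : Series → Series → Series
(f ⊕ g) n = f n + g n

_⊖_ : Series → Series → Series
(f ⊖ g) n = f n - g n

_⊛_ : Series → Series → Series
(f ⊛ g) n = sumℚ (map (λ i → f i * g (n ∸ i)) (range 0 (suc n)))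

_·_ : ℚ → Series → Series
(c · f) n = c * f n

ΣS : ℕ → ℕ → (ℕ → Series) → Series
ΣS a b F n = sumℚ (map (λ i → F i n) (range a b))

X^ : ℕ → Series
X^ i n = if n ≡ᵇ i then 1ℚ else 0ℚ

one : Series
one = X^ 0

-- P(x) = Σ_{n≥0} (n+1)^{n-1}/n! x^n   (for n = 0 the coefficient is 1^{-1}/0! = 1,
-- which is what 1^(0∸1) = 1^0 = 1 gives)
P : Series
P n = (+ (suc n ℕ.^ (n ∸ 1))) /! n

R : ℕ → Series
R k n = if k ≤ᵇ n then (+ pLe n (n ∸ k)) /! n else 0ℚ

signedPow : ℕ → ℕ → ℤ
signedPow i m = (-[1+ 0 ] ℤ.^ i) ℤ.* (+ (m ℕ.^ i))

module Submission where

open import Defs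
open import Data.Product using (_×_)
open import Data.Nat using (ℕ; suc; _∸_; _≤_)
open import Data.Integer using (+_)
open import Relation.Binary.PropositionalEquality using (_≗_)

open import Algebra.Bundles using (CommutativeRing)
open import Data.Bool using (Bool; true; false; if_then_else_; T; _∧_)
open import Data.Bool.Properties using (T-∧)
open import Data.Empty using (⊥-elim)
open import Data.List using (List; []; _∷_; replicate; drop; map; concatMap; applyUpTo; _++_)
open import Data.List.Relation.Unary.All using (All; []; _∷_)
import Data.List.Relation.Unary.All as All
open import Data.List.Relation.Unary.All.Properties using (concat⁺; map⁺; applyUpTo⁺₁)
open import Data.Maybe using (just)
import Data.Maybe as Maybe
open import Data.Nat as ℕ using (zero; z≤n; s≤s; _!; _≤ᵇ_; _<ᵇ_; _≡ᵇ_)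
import Data.Nat.Properties as ℕ
import Data.Nat.Tactic.RingSolver as ℕ-Solver
open import Data.Nat.Combinatorics
  using (_C_; nCk+nC[k+1]≡[n+1]C[k+1]; k>n⇒nCk≡0; nCk≡n!/k![n-k]!; k![n∸k]!∣n!; nCk≡nC[n∸k]; nCn≡1)
open import Data.Nat.DivMod using (m/n*n≡m)
open import Data.Nat.Induction using (<-rec)
open import Data.Product using (Σ-syntax; _,_)
open import Data.Sum using (_⊎_; inj₁; inj₂)
open import Function.Bundles using (Equivalence)
open import Relation.Nullary using (¬_; yes; no)
open import Relation.Binary.PropositionalEquality
  using (_≡_; _≢_; refl; sym; trans; cong; cong₂; subst; module ≡-Reasoning)

-- Everything is proved on the integer sequences  c(n) = n!·[x^n](series), for
-- which products of exponential series become binomial convolutions.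
--  * Combinatorics: a sequence with entries ≤ s+1 is a parking function iff the
--    cars preferring s+1 fit and the others form a parking function (via the
--    criterion "after every position j there is room for the cars preferring a
--    space after j").  Counting by the number of such cars gives a binomial
--    recurrence for n!·[x^n]R_k below the diagonal n = k, and boundary values
--    δ n k on and above it.
--  * Algebra: the closed form n!·[x^n](P A_k - B_k) satisfies the same
--    recurrence (binomial theorem) and the same boundary values (Abel's identity
--    Σ_j C(n,j)(j+1)^(j-1)(w+n-j)^(n-j) = (w+n+1)^n, proved by expanding it in
--    w and evaluating at w = -(n+1), where it becomes an alternating sum).
--  * Hence the two agree; the recurrence of the theorem is the recurrence of the
--    closed form, and R_0, R_1 are its cases k = 0, 1.
-- The file develops, in order: finite sums in a commutative ring, binomial
-- coefficients, alternating sums and Abel's identity, the closed form, parking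
-- functions and the counting recurrence, exponential generating functions over
-- ℚ (translating to the series of Defs), and finally the theorem.

-- The summation index is a natural number (not a Fin) because the
-- summands below depend arithmetically on it (n ∸ i, i + j, …).
module FiniteSums {c ℓ} (K : CommutativeRing c ℓ) where

  open CommutativeRing K renaming (refl to ≈-refl; sym to ≈-sym; trans to ≈-trans)
  open import Relation.Binary.Reasoning.Setoid setoid
  open import Algebra.Properties.CommutativeSemigroup +-commutativeSemigroup using (interchange)
  open import Algebra.Properties.AbelianGroup +-abelianGroup using (⁻¹-∙-comm; ε⁻¹≈ε)

  ∑ : ℕ → (ℕ → Carrier) → Carrier
  ∑ zero    f = 0#
  ∑ (suc n) f = f 0 + ∑ n (λ i → f (suc i))

  syntax ∑ n (λ i → e) = ∑[ i < n ] e

  ∑-cong : ∀ n {f g : ℕ → Carrier} → (∀ i → i ℕ.< n → f i ≈ g i) → ∑ n f ≈ ∑ n g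
  ∑-cong zero    eq = ≈-refl
  ∑-cong (suc n) eq = +-cong (eq 0 (s≤s z≤n)) (∑-cong n (λ i i<n → eq (suc i) (s≤s i<n)))

  ∑-zero : ∀ n {f : ℕ → Carrier} → (∀ i → i ℕ.< n → f i ≈ 0#) → ∑ n f ≈ 0#
  ∑-zero zero    eq = ≈-refl
  ∑-zero (suc n) eq = begin
    _ + _ ≈⟨ +-cong (eq 0 (s≤s z≤n)) (∑-zero n (λ i i<n → eq (suc i) (s≤s i<n))) ⟩
    0# + 0# ≈⟨ +-identityˡ 0# ⟩
    0# ∎

  ∑-+ : ∀ n (f g : ℕ → Carrier) → ∑[ i < n ] (f i + g i) ≈ ∑ n f + ∑ n g
  ∑-+ zero    f g = ≈-sym (+-identityˡ 0#)
  ∑-+ (suc n) f g = begin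
    (f 0 + g 0) + ∑[ i < n ] (f (suc i) + g (suc i))
      ≈⟨ +-congˡ (∑-+ n (λ i → f (suc i)) (λ i → g (suc i))) ⟩
    (f 0 + g 0) + (∑[ i < n ] f (suc i) + ∑[ i < n ] g (suc i))
      ≈⟨ interchange (f 0) (g 0) _ _ ⟩
    ∑ (suc n) f + ∑ (suc n) g ∎

  ∑-*ˡ : ∀ n a (f : ℕ → Carrier) → ∑[ i < n ] (a * f i) ≈ a * ∑ n f
  ∑-*ˡ zero    a f = ≈-sym (zeroʳ a)
  ∑-*ˡ (suc n) a f = begin
    a * f 0 + ∑[ i < n ] (a * f (suc i)) ≈⟨ +-congˡ (∑-*ˡ n a (λ i → f (suc i))) ⟩
    a * f 0 + a * ∑[ i < n ] f (suc i)   ≈⟨ distribˡ a (f 0) _ ⟨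
    a * ∑ (suc n) f ∎

  ∑-*ˡ₂ : ∀ n a b (f : ℕ → Carrier) → ∑[ i < n ] (a * (b * f i)) ≈ a * (b * ∑ n f)
  ∑-*ˡ₂ n a b f = ≈-trans (∑-*ˡ n a (λ i → b * f i)) (*-congˡ (∑-*ˡ n b f))

  ∑-neg : ∀ n (f : ℕ → Carrier) → ∑[ i < n ] (- f i) ≈ - ∑ n f
  ∑-neg zero    f = ≈-sym ε⁻¹≈ε
  ∑-neg (suc n) f = ≈-trans (+-congˡ (∑-neg n (λ i → f (suc i)))) (⁻¹-∙-comm (f 0) _)

  ∑-- : ∀ n (f g : ℕ → Carrier) → ∑[ i < n ] (f i - g i) ≈ ∑ n f - ∑ n g
  ∑-- n f g = ≈-trans (∑-+ n f (λ i → - g i)) (+-congˡ (∑-neg n g))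

  ∑-last : ∀ n (f : ℕ → Carrier) → ∑ (suc n) f ≈ ∑ n f + f n
  ∑-last zero    f = +-comm (f 0) 0#
  ∑-last (suc n) f = begin
    f 0 + ∑ (suc n) (λ i → f (suc i))            ≈⟨ +-congˡ (∑-last n (λ i → f (suc i))) ⟩
    f 0 + (∑[ i < n ] f (suc i) + f (suc n))     ≈⟨ +-assoc (f 0) _ _ ⟨
    ∑ (suc n) f + f (suc n) ∎

  ∑-extend : ∀ {m n} (f : ℕ → Carrier) → m ℕ.≤ n →
             (∀ i → m ℕ.≤ i → i ℕ.< n → f i ≈ 0#) → ∑ n f ≈ ∑ m f
  ∑-extend {m} f m≤n vanish with ℕ.m≤n⇒∃[o]m+o≡n m≤n
  ... | k , refl = pad m f vanish
    where
    pad : ∀ m (f : ℕ → Carrier) → (∀ i → m ℕ.≤ i → i ℕ.< m ℕ.+ k → f i ≈ 0#) →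
          ∑ (m ℕ.+ k) f ≈ ∑ m f
    pad zero    f vanish = ∑-zero k (λ i i<k → vanish i z≤n i<k)
    pad (suc m) f vanish =
      +-congˡ (pad m (λ i → f (suc i)) (λ i m≤i i<m+k → vanish (suc i) (s≤s m≤i) (s≤s i<m+k)))

  ∑-swap : ∀ n m (f : ℕ → ℕ → Carrier) →
           ∑[ i < n ] ∑[ j < m ] f i j ≈ ∑[ j < m ] ∑[ i < n ] f i j
  ∑-swap zero    m f = ≈-sym (∑-zero m (λ _ _ → ≈-refl))
  ∑-swap (suc n) m f = begin
    ∑ m (f 0) + ∑[ i < n ] ∑ m (f (suc i))       ≈⟨ +-congˡ (∑-swap n m (λ i → f (suc i))) ⟩
    ∑ m (f 0) + ∑[ j < m ] ∑[ i < n ] f (suc i) j ≈⟨ ∑-+ m (f 0) _ ⟨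
    ∑[ j < m ] ∑[ i < suc n ] f i j ∎

  ∑-single : ∀ n k (f : ℕ → Carrier) → k ℕ.< n →
             (∀ i → i ℕ.< n → i ≢ k → f i ≈ 0#) → ∑ n f ≈ f k
  ∑-single (suc n) zero    f _ vanish = begin
    f 0 + ∑[ i < n ] f (suc i) ≈⟨ +-congˡ (∑-zero n (λ i i<n → vanish (suc i) (s≤s i<n) (λ ()))) ⟩
    f 0 + 0#                   ≈⟨ +-identityʳ (f 0) ⟩
    f 0 ∎
  ∑-single (suc n) (suc k) f (s≤s k<n) vanish = begin
    f 0 + ∑[ i < n ] f (suc i) ≈⟨ +-congʳ (vanish 0 (s≤s z≤n) (λ ())) ⟩
    0# + ∑[ i < n ] f (suc i)  ≈⟨ +-identityˡ _ ⟩
    ∑[ i < n ] f (suc i)       ≈⟨ ∑-single n k (λ i → f (suc i)) k<n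
                                    (λ i i<n i≢k → vanish (suc i) (s≤s i<n) (λ e → i≢k (ℕ.suc-injective e))) ⟩
    f (suc k) ∎

  ∑-reverse : ∀ n (f : ℕ → Carrier) → ∑ (suc n) f ≈ ∑[ i < suc n ] f (n ∸ i)
  ∑-reverse zero    f = ≈-refl
  ∑-reverse (suc n) f = begin
    f 0 + ∑ (suc n) (λ i → f (suc i))               ≈⟨ +-congˡ (∑-reverse n (λ i → f (suc i))) ⟩
    f 0 + ∑[ i < suc n ] f (suc (n ∸ i))            ≈⟨ +-comm (f 0) _ ⟩
    ∑[ i < suc n ] f (suc (n ∸ i)) + f 0            ≈⟨ +-cong (∑-cong (suc n) shift) (reflexive (cong f (ℕ.n∸n≡0 n))) ⟨
    ∑[ i < suc n ] f (suc n ∸ i) + f (suc n ∸ suc n) ≈⟨ ∑-last (suc n) (λ i → f (suc n ∸ i)) ⟨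
    ∑[ i < suc (suc n) ] f (suc n ∸ i) ∎
    where
    shift : ∀ i → i ℕ.< suc n → f (suc n ∸ i) ≈ f (suc (n ∸ i))
    shift i (s≤s i≤n) = reflexive (cong f (ℕ.+-∸-assoc 1 i≤n))

-- Integer and rational arithmetic (imported after FiniteSums, whose ring
-- operations would otherwise clash with these names).
open import Data.Integer as ℤ using (ℤ; 0ℤ; 1ℤ; -1ℤ; _+_; _*_; _-_; -_; _^_)
import Data.Integer.Properties as ℤ
open import Data.Integer.Tactic.RingSolver using (solve-∀)
open import Data.Rational as ℚ using (ℚ; 0ℚ; 1ℚ; _/_; toℚᵘ)
import Data.Rational.Properties as ℚ
open import Data.Rational.Unnormalised as ℚᵘ using (mkℚᵘ; *≡*) renaming (_≃_ to _≃ᵘ_)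
import Data.Rational.Unnormalised.Properties as ℚᵘ

open FiniteSums ℤ.+-*-commutativeRing
module ℚΣ = FiniteSums ℚ.+-*-commutativeRing

∸-comm : ∀ m n o → m ∸ n ∸ o ≡ m ∸ o ∸ n
∸-comm m n o = trans (ℕ.∸-+-assoc m n o) (trans (cong (m ∸_) (ℕ.+-comm n o)) (sym (ℕ.∸-+-assoc m o n)))

if-≤ᵇ-true : ∀ {A : Set} {m n} {a b : A} → m ℕ.≤ n → (if m ≤ᵇ n then a else b) ≡ a
if-≤ᵇ-true {m = m} {n} m≤n with m ≤ᵇ n | ℕ.≤⇒≤ᵇ m≤n
... | true | _ = refl

if-≤ᵇ-false : ∀ {A : Set} {m n} {a b : A} → ¬ m ℕ.≤ n → (if m ≤ᵇ n then a else b) ≡ b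
if-≤ᵇ-false {m = m} {n} m≰n with m ≤ᵇ n in eq
... | true  = ⊥-elim (m≰n (ℕ.≤ᵇ⇒≤ m n (subst T (sym eq) _)))
... | false = refl

≡ᵇ-refl : ∀ a → (a ≡ᵇ a) ≡ true
≡ᵇ-refl zero    = refl
≡ᵇ-refl (suc a) = ≡ᵇ-refl a

≡ᵇ-true : ∀ {a b} → (a ≡ᵇ b) ≡ true → a ≡ b
≡ᵇ-true {a} {b} e = ℕ.≡ᵇ⇒≡ a b (subst T (sym e) _)

≡ᵇ-false : ∀ {a b} → a ≢ b → (a ≡ᵇ b) ≡ false
≡ᵇ-false {a} {b} a≢b with a ≡ᵇ b in e
... | true  = ⊥-elim (a≢b (≡ᵇ-true e))
... | false = refl

<ᵇ-false : ∀ {a j} → a ℕ.≤ j → (j <ᵇ a) ≡ false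
<ᵇ-false {a} {j} a≤j with j <ᵇ a in e
... | true  = ⊥-elim (ℕ.<⇒≱ (ℕ.<ᵇ⇒< j a (subst T (sym e) _)) a≤j)
... | false = refl

T-extensional : ∀ {x y} → (T x → T y) → (T y → T x) → x ≡ y
T-extensional {true}  {true}  _ _ = refl
T-extensional {true}  {false} f _ = ⊥-elim (f _)
T-extensional {false} {true}  _ g = ⊥-elim (g _)
T-extensional {false} {false} _ _ = refl

-- Binomial coefficients (those of the library, n C k = 0 for k > n).

pascal : ∀ n k → suc n C suc k ≡ (n C k) ℕ.+ (n C suc k)
pascal n k = sym (nCk+nC[k+1]≡[n+1]C[k+1] n k)

C-factorials : ∀ {n k} → k ℕ.≤ n → (n C k) ℕ.* (k ! ℕ.* (n ∸ k) !) ≡ n !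
C-factorials {n} {k} k≤n =
  trans (cong (ℕ._* (k ! ℕ.* (n ∸ k) !)) (nCk≡n!/k![n-k]! k≤n)) (m/n*n≡m (k![n∸k]!∣n! k≤n))
  where instance _ = ℕ._!*_!≢0 k (n ∸ k)

multinomial : ∀ {n} i j → i ℕ.+ j ℕ.≤ n →
              (n C i) ℕ.* ((n ∸ i) C j) ℕ.* (i ! ℕ.* (j ! ℕ.* (n ∸ i ∸ j) !)) ≡ n !
multinomial {n} i j i+j≤n = begin
  (n C i) ℕ.* ((n ∸ i) C j) ℕ.* (i ! ℕ.* (j ! ℕ.* (n ∸ i ∸ j) !))
    ≡⟨ rearrange (n C i) ((n ∸ i) C j) (i !) (j !) ((n ∸ i ∸ j) !) ⟩
  (n C i) ℕ.* (i ! ℕ.* (((n ∸ i) C j) ℕ.* (j ! ℕ.* (n ∸ i ∸ j) !)))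
    ≡⟨ cong (λ t → (n C i) ℕ.* (i ! ℕ.* t)) (C-factorials j≤n-i) ⟩
  (n C i) ℕ.* (i ! ℕ.* (n ∸ i) !)
    ≡⟨ C-factorials (ℕ.≤-trans (ℕ.m≤m+n i j) i+j≤n) ⟩
  n ! ∎
  where
  open ≡-Reasoning
  j≤n-i : j ℕ.≤ n ∸ i
  j≤n-i = ℕ.m+n≤o⇒m≤o∸n j (subst (ℕ._≤ n) (ℕ.+-comm i j) i+j≤n)
  rearrange : ∀ a b c d e → a ℕ.* b ℕ.* (c ℕ.* (d ℕ.* e)) ≡ a ℕ.* (c ℕ.* (b ℕ.* (d ℕ.* e)))
  rearrange = ℕ-Solver.solve-∀

C-product-vanish : ∀ n i j → n ℕ.< i ℕ.+ j → (n C i) ℕ.* ((n ∸ i) C j) ≡ 0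
C-product-vanish n i j n<i+j with i ℕ.≤? n
... | no  i≰n = cong (ℕ._* ((n ∸ i) C j)) (k>n⇒nCk≡0 (ℕ.≰⇒> i≰n))
... | yes i≤n = trans (cong ((n C i) ℕ.*_) (k>n⇒nCk≡0 n-i<j)) (ℕ.*-zeroʳ (n C i))
  where n-i<j = ℕ.+-cancelˡ-< i (n ∸ i) j (subst (ℕ._< i ℕ.+ j) (sym (ℕ.m+[n∸m]≡n i≤n)) n<i+j)

C-trinomial : ∀ n i j → (n C i) ℕ.* ((n ∸ i) C j) ≡ (n C j) ℕ.* ((n ∸ j) C i)
C-trinomial n i j with i ℕ.+ j ℕ.≤? n
... | no  i+j≰n = trans (C-product-vanish n i j (ℕ.≰⇒> i+j≰n))
                        (sym (C-product-vanish n j i (subst (n ℕ.<_) (ℕ.+-comm i j) (ℕ.≰⇒> i+j≰n))))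
... | yes i+j≤n = ℕ.*-cancelʳ-≡ _ _ (i ! ℕ.* (j ! ℕ.* (n ∸ i ∸ j) !)) (begin
  (n C i) ℕ.* ((n ∸ i) C j) ℕ.* (i ! ℕ.* (j ! ℕ.* (n ∸ i ∸ j) !))
    ≡⟨ multinomial i j i+j≤n ⟩
  n !
    ≡⟨ multinomial j i (subst (ℕ._≤ n) (ℕ.+-comm i j) i+j≤n) ⟨
  (n C j) ℕ.* ((n ∸ j) C i) ℕ.* (j ! ℕ.* (i ! ℕ.* (n ∸ j ∸ i) !))
    ≡⟨ cong ((n C j) ℕ.* ((n ∸ j) C i) ℕ.*_) (swap-front (j !) (i !) _) ⟩
  (n C j) ℕ.* ((n ∸ j) C i) ℕ.* (i ! ℕ.* (j ! ℕ.* (n ∸ j ∸ i) !))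
    ≡⟨ cong (λ t → (n C j) ℕ.* ((n ∸ j) C i) ℕ.* (i ! ℕ.* (j ! ℕ.* t !))) (∸-comm n j i) ⟩
  (n C j) ℕ.* ((n ∸ j) C i) ℕ.* (i ! ℕ.* (j ! ℕ.* (n ∸ i ∸ j) !)) ∎)
  where
  open ≡-Reasoning
  swap-front : ∀ a b c → a ℕ.* (b ℕ.* c) ≡ b ℕ.* (a ℕ.* c)
  swap-front = ℕ-Solver.solve-∀
  instance
    _ = ℕ.m*n≢0 (i !) (j ! ℕ.* (n ∸ i ∸ j) !) {{i ℕ.!≢0}} {{ℕ._!*_!≢0 j (n ∸ i ∸ j)}}

C-guarded : ∀ m k (x y : ℤ) → (k ℕ.≤ m → x ≡ y) → + (m C k) * x ≡ + (m C k) * y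
C-guarded m k x y agree with k ℕ.≤? m
... | yes k≤m = cong (+ (m C k) *_) (agree k≤m)
... | no  k≰m = trans (cong (λ c → + c * x) (k>n⇒nCk≡0 (ℕ.≰⇒> k≰m)))
                      (trans (ℤ.*-zeroˡ x) (sym (trans (cong (λ c → + c * y) (k>n⇒nCk≡0 (ℕ.≰⇒> k≰m))) (ℤ.*-zeroˡ y))))

pascal-∑ : ∀ n (g : ℕ → ℤ) →
           ∑[ i < suc (suc n) ] (+ (suc n C i) * g i)
           ≡ ∑[ i < suc n ] (+ (n C i) * g i) + ∑[ i < suc n ] (+ (n C i) * g (suc i))
pascal-∑ n g = begin
  g₀ + ∑[ i < suc n ] (+ (suc n C suc i) * g (suc i))
    ≡⟨ cong (λ t → g₀ + t) (trans (∑-cong (suc n) (λ i _ → split i)) (∑-+ (suc n) A B)) ⟩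
  g₀ + (∑ (suc n) A + ∑ (suc n) B)
    ≡⟨ cong (λ t → g₀ + (∑ (suc n) A + t)) (trans (∑-last n B) (cong (λ t → ∑ n B + t) B-top)) ⟩
  g₀ + (∑ (suc n) A + (∑ n B + 0ℤ))
    ≡⟨ regroup g₀ (∑ (suc n) A) (∑ n B) ⟩
  (g₀ + ∑ n B) + ∑ (suc n) A ∎
  where
  open ≡-Reasoning
  g₀ = 1ℤ * g 0
  A B : ℕ → ℤ
  A i = + (n C i) * g (suc i)
  B i = + (n C suc i) * g (suc i)
  split : ∀ i → + (suc n C suc i) * g (suc i) ≡ A i + B i
  split i = trans (cong (λ c → + c * g (suc i)) (pascal n i))
                  (trans (cong (_* g (suc i)) (ℤ.pos-+ (n C i) (n C suc i)))
                         (ℤ.*-distribʳ-+ (g (suc i)) (+ (n C i)) (+ (n C suc i))))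
  B-top : B n ≡ 0ℤ
  B-top = trans (cong (λ c → + c * g (suc n)) (k>n⇒nCk≡0 (ℕ.n<1+n n))) (ℤ.*-zeroˡ (g (suc n)))
  regroup : ∀ a b c → a + (b + (c + 0ℤ)) ≡ (a + c) + b
  regroup = solve-∀

binomial : ∀ n (x y : ℤ) → (x + y) ^ n ≡ ∑[ i < suc n ] (+ (n C i) * (x ^ i * y ^ (n ∸ i)))
binomial zero    x y = refl
binomial (suc n) x y = sym (begin
  ∑[ i < suc (suc n) ] (+ (suc n C i) * (x ^ i * y ^ (suc n ∸ i)))
    ≡⟨ pascal-∑ n (λ i → x ^ i * y ^ (suc n ∸ i)) ⟩
  ∑[ i < suc n ] (+ (n C i) * (x ^ i * y ^ (suc n ∸ i))) + ∑[ i < suc n ] (+ (n C i) * (x ^ suc i * y ^ (n ∸ i)))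
    ≡⟨ cong₂ _+_ (trans (∑-cong (suc n) y-term) (∑-*ˡ (suc n) y S))
                 (trans (∑-cong (suc n) (λ i _ → x-term i)) (∑-*ˡ (suc n) x S)) ⟩
  y * ∑ (suc n) S + x * ∑ (suc n) S
    ≡⟨ collect x y (∑ (suc n) S) ⟩
  (x + y) * ∑ (suc n) S
    ≡⟨ cong ((x + y) *_) (binomial n x y) ⟨
  (x + y) ^ suc n ∎)
  where
  open ≡-Reasoning
  S : ℕ → ℤ
  S i = + (n C i) * (x ^ i * y ^ (n ∸ i))
  y-term : ∀ i → i ℕ.< suc n → + (n C i) * (x ^ i * y ^ (suc n ∸ i)) ≡ y * S i
  y-term i (s≤s i≤n) = trans (cong (λ e → + (n C i) * (x ^ i * y ^ e)) (ℕ.+-∸-assoc 1 i≤n))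
                             (move (+ (n C i)) (x ^ i) y (y ^ (n ∸ i)))
    where move : ∀ c a y b → c * (a * (y * b)) ≡ y * (c * (a * b))
          move = solve-∀
  x-term : ∀ i → + (n C i) * (x ^ suc i * y ^ (n ∸ i)) ≡ x * S i
  x-term i = move (+ (n C i)) x (x ^ i) (y ^ (n ∸ i))
    where move : ∀ c x a b → c * ((x * a) * b) ≡ x * (c * (a * b))
          move = solve-∀
  collect : ∀ x y s → y * s + x * s ≡ (x + y) * s
  collect = solve-∀

∑-C-truncate : ∀ {m n} (F : ℕ → ℤ) → m ℕ.≤ n →
               ∑[ r < suc n ] (+ (m C r) * F r) ≡ ∑[ r < suc m ] (+ (m C r) * F r)
∑-C-truncate F m≤n = ∑-extend _ (s≤s m≤n)
  (λ r m<r _ → trans (cong (λ c → + c * F r) (k>n⇒nCk≡0 m<r)) (ℤ.*-zeroˡ (F r)))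

binomial-convolution-comm : ∀ n (u v : ℕ → ℤ) →
  ∑[ j < suc n ] (+ (n C j) * (u j * v (n ∸ j))) ≡ ∑[ j < suc n ] (+ (n C j) * (v j * u (n ∸ j)))
binomial-convolution-comm n u v =
  trans (∑-reverse n (λ j → + (n C j) * (u j * v (n ∸ j)))) (∑-cong (suc n) reflect)
  where
  reflect : ∀ j → j ℕ.< suc n →
            + (n C (n ∸ j)) * (u (n ∸ j) * v (n ∸ (n ∸ j))) ≡ + (n C j) * (v j * u (n ∸ j))
  reflect j (s≤s j≤n) = begin
    + (n C (n ∸ j)) * (u (n ∸ j) * v (n ∸ (n ∸ j)))
      ≡⟨ cong₂ (λ c i → + c * (u (n ∸ j) * v i)) (sym (nCk≡nC[n∸k] j≤n)) (ℕ.m∸[m∸n]≡n j≤n) ⟩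
    + (n C j) * (u (n ∸ j) * v j)
      ≡⟨ cong (+ (n C j) *_) (ℤ.*-comm (u (n ∸ j)) (v j)) ⟩
    + (n C j) * (v j * u (n ∸ j)) ∎
    where open ≡-Reasoning

C-into-binomial-sum : ∀ n i (G : ℕ → ℤ) →
  + (n C i) * ∑[ j < suc (n ∸ i) ] (+ ((n ∸ i) C j) * G j) ≡ ∑[ j < suc n ] (+ ((n C i) ℕ.* ((n ∸ i) C j)) * G j)
C-into-binomial-sum n i G = begin
  + (n C i) * ∑[ j < suc (n ∸ i) ] (+ ((n ∸ i) C j) * G j)
    ≡⟨ cong (+ (n C i) *_) (∑-C-truncate G (ℕ.m∸n≤m n i)) ⟨
  + (n C i) * ∑[ j < suc n ] (+ ((n ∸ i) C j) * G j)
    ≡⟨ ∑-*ˡ (suc n) (+ (n C i)) (λ j → + ((n ∸ i) C j) * G j) ⟨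
  ∑[ j < suc n ] (+ (n C i) * (+ ((n ∸ i) C j) * G j))
    ≡⟨ ∑-cong (suc n) (λ j _ → trans (sym (ℤ.*-assoc (+ (n C i)) _ (G j)))
                                     (cong (_* G j) (sym (ℤ.pos-* (n C i) ((n ∸ i) C j))))) ⟩
  ∑[ j < suc n ] (+ ((n C i) ℕ.* ((n ∸ i) C j)) * G j) ∎
  where open ≡-Reasoning

binomial-convolution-shift : ∀ n b (u : ℕ → ℤ) (F : ℕ → ℕ → ℤ) →
  ∑[ i < b ] (+ (n C i) * ∑[ j < suc (n ∸ i) ] (+ ((n ∸ i) C j) * (u j * F i (n ∸ i ∸ j))))
  ≡ ∑[ j < suc n ] (+ (n C j) * (u j * ∑[ i < b ] (+ ((n ∸ j) C i) * F i (n ∸ j ∸ i))))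
binomial-convolution-shift n b u F = begin
  ∑[ i < b ] (+ (n C i) * ∑[ j < suc (n ∸ i) ] (+ ((n ∸ i) C j) * (u j * F i (n ∸ i ∸ j))))
    ≡⟨ ∑-cong b (λ i _ → C-into-binomial-sum n i (λ j → u j * F i (n ∸ i ∸ j))) ⟩
  ∑[ i < b ] ∑[ j < suc n ] (+ ((n C i) ℕ.* ((n ∸ i) C j)) * (u j * F i (n ∸ i ∸ j)))
    ≡⟨ ∑-swap b (suc n) (λ i j → + ((n C i) ℕ.* ((n ∸ i) C j)) * (u j * F i (n ∸ i ∸ j))) ⟩
  ∑[ j < suc n ] ∑[ i < b ] (+ ((n C i) ℕ.* ((n ∸ i) C j)) * (u j * F i (n ∸ i ∸ j)))
    ≡⟨ ∑-cong (suc n) (λ j _ → ∑-cong b (λ i _ → reindex i j)) ⟩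
  ∑[ j < suc n ] ∑[ i < b ] (+ (n C j) * (u j * (+ ((n ∸ j) C i) * F i (n ∸ j ∸ i))))
    ≡⟨ ∑-cong (suc n) (λ j _ → ∑-*ˡ₂ b (+ (n C j)) (u j) (λ i → + ((n ∸ j) C i) * F i (n ∸ j ∸ i))) ⟩
  ∑[ j < suc n ] (+ (n C j) * (u j * ∑[ i < b ] (+ ((n ∸ j) C i) * F i (n ∸ j ∸ i)))) ∎
  where
  open ≡-Reasoning
  reindex : ∀ i j → + ((n C i) ℕ.* ((n ∸ i) C j)) * (u j * F i (n ∸ i ∸ j))
                    ≡ + (n C j) * (u j * (+ ((n ∸ j) C i) * F i (n ∸ j ∸ i)))
  reindex i j = begin
    + ((n C i) ℕ.* ((n ∸ i) C j)) * (u j * F i (n ∸ i ∸ j))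
      ≡⟨ cong₂ (λ c m → + c * (u j * F i m)) (C-trinomial n i j) (∸-comm n i j) ⟩
    + ((n C j) ℕ.* ((n ∸ j) C i)) * (u j * F i (n ∸ j ∸ i))
      ≡⟨ cong (_* (u j * F i (n ∸ j ∸ i))) (ℤ.pos-* (n C j) ((n ∸ j) C i)) ⟩
    + (n C j) * + ((n ∸ j) C i) * (u j * F i (n ∸ j ∸ i))
      ≡⟨ regroup (+ (n C j)) (+ ((n ∸ j) C i)) (u j) _ ⟩
    + (n C j) * (u j * (+ ((n ∸ j) C i) * F i (n ∸ j ∸ i))) ∎
    where
    regroup : ∀ a b c d → (a * b) * (c * d) ≡ a * (c * (b * d))
    regroup = solve-∀

-- Alternating sums and Abel's identity.

^-distrib-* : ∀ (x y : ℤ) n → (x * y) ^ n ≡ x ^ n * y ^ n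
^-distrib-* x y zero    = refl
^-distrib-* x y (suc n) = trans (cong ((x * y) *_) (^-distrib-* x y n)) (interchange x y (x ^ n) (y ^ n))
  where interchange : ∀ a b c d → (a * b) * (c * d) ≡ (a * c) * (b * d)
        interchange = solve-∀

pos-^ : ∀ m n → + (m ℕ.^ n) ≡ (+ m) ^ n
pos-^ m zero    = refl
pos-^ m (suc n) = trans (ℤ.pos-* m (m ℕ.^ n)) (cong (+ m *_) (pos-^ m n))

sgn : ℕ → ℤ
sgn j = -1ℤ ^ j

sgn-square : ∀ j → sgn j * sgn j ≡ 1ℤ
sgn-square zero    = refl
sgn-square (suc j) = trans (square-neg (sgn j)) (sgn-square j)
  where square-neg : ∀ a → (-1ℤ * a) * (-1ℤ * a) ≡ a * a
        square-neg = solve-∀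

sgn-∸ : ∀ {n j} → j ℕ.≤ n → sgn (n ∸ j) ≡ sgn n * sgn j
sgn-∸ {n} {j} j≤n = sym (begin
  sgn n * sgn j                   ≡⟨ cong (λ m → sgn m * sgn j) (ℕ.m∸n+n≡m j≤n) ⟨
  sgn (n ∸ j ℕ.+ j) * sgn j       ≡⟨ cong (_* sgn j) (ℤ.^-distribˡ-+-* -1ℤ (n ∸ j) j) ⟩
  sgn (n ∸ j) * sgn j * sgn j     ≡⟨ ℤ.*-assoc (sgn (n ∸ j)) (sgn j) (sgn j) ⟩
  sgn (n ∸ j) * (sgn j * sgn j)   ≡⟨ cong (sgn (n ∸ j) *_) (sgn-square j) ⟩
  sgn (n ∸ j) * 1ℤ                ≡⟨ ℤ.*-identityʳ (sgn (n ∸ j)) ⟩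
  sgn (n ∸ j) ∎)
  where open ≡-Reasoning

Δ : (ℕ → ℤ) → ℕ → ℤ
Δ f j = f (suc j) - f j

-- The alternating binomial sum Σ_j (-1)^j C(n,j) f(j), i.e. (-1)^n (Δⁿ f)(0).
alternating : ℕ → (ℕ → ℤ) → ℤ
alternating n f = ∑[ j < suc n ] (+ (n C j) * (sgn j * f j))

alternating-cong : ∀ n {f g : ℕ → ℤ} → (∀ j → f j ≡ g j) → alternating n f ≡ alternating n g
alternating-cong n eq = ∑-cong (suc n) (λ j _ → cong (λ t → + (n C j) * (sgn j * t)) (eq j))

alternating-suc : ∀ n f → alternating (suc n) f ≡ - alternating n (Δ f)
alternating-suc n f = begin
  alternating (suc n) f
    ≡⟨ pascal-∑ n (λ j → sgn j * f j) ⟩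
  alternating n f + ∑[ j < suc n ] (+ (n C j) * (sgn (suc j) * f (suc j)))
    ≡⟨ cong (λ t → alternating n f + t) (trans (∑-cong (suc n) (λ j _ → flip (+ (n C j)) (sgn j) (f (suc j))))
                                        (∑-neg (suc n) (λ j → + (n C j) * (sgn j * f (suc j))))) ⟩
  alternating n f - alternating n (λ j → f (suc j))
    ≡⟨ negate-difference (alternating n f) (alternating n (λ j → f (suc j))) ⟩
  - (alternating n (λ j → f (suc j)) - alternating n f)
    ≡⟨ cong -_ (∑-- (suc n) (λ j → + (n C j) * (sgn j * f (suc j))) (λ j → + (n C j) * (sgn j * f j))) ⟨
  - ∑[ j < suc n ] (+ (n C j) * (sgn j * f (suc j)) - + (n C j) * (sgn j * f j))
    ≡⟨ cong -_ (∑-cong (suc n) (λ j _ → distrib (+ (n C j)) (sgn j) (f (suc j)) (f j))) ⟩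
  - alternating n (Δ f) ∎
  where
  open ≡-Reasoning
  flip : ∀ c s x → c * ((-1ℤ * s) * x) ≡ - (c * (s * x))
  flip = solve-∀
  negate-difference : ∀ a b → a - b ≡ - (b - a)
  negate-difference = solve-∀
  distrib : ∀ c s x y → c * (s * x) - c * (s * y) ≡ c * (s * (x - y))
  distrib = solve-∀

alternating-linear : ∀ n m (c : ℕ → ℤ) (g : ℕ → ℕ → ℤ) →
  alternating n (λ j → ∑[ i < m ] (c i * g i j)) ≡ ∑[ i < m ] (c i * alternating n (g i))
alternating-linear n m c g = begin
  ∑[ j < suc n ] (+ (n C j) * (sgn j * ∑[ i < m ] (c i * g i j)))
    ≡⟨ ∑-cong (suc n) (λ j _ → trans (cong (+ (n C j) *_) (sym (∑-*ˡ m (sgn j) (λ i → c i * g i j)))) (sym (∑-*ˡ m (+ (n C j)) (λ i → sgn j * (c i * g i j))))) ⟩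
  ∑[ j < suc n ] ∑[ i < m ] (+ (n C j) * (sgn j * (c i * g i j)))
    ≡⟨ ∑-swap (suc n) m (λ j i → + (n C j) * (sgn j * (c i * g i j))) ⟩
  ∑[ i < m ] ∑[ j < suc n ] (+ (n C j) * (sgn j * (c i * g i j)))
    ≡⟨ ∑-cong m (λ i _ → trans (∑-cong (suc n) (λ j _ → pull (+ (n C j)) (sgn j) (c i) (g i j))) (∑-*ˡ (suc n) (c i) (λ j → + (n C j) * (sgn j * g i j)))) ⟩
  ∑[ i < m ] (c i * alternating n (g i)) ∎
  where
  open ≡-Reasoning
  pull : ∀ a s c x → a * (s * (c * x)) ≡ c * (a * (s * x))
  pull = solve-∀

power-difference : ∀ m (x : ℤ) → (x + 1ℤ) ^ m - x ^ m ≡ ∑[ i < m ] (+ (m C i) * x ^ i)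
power-difference m x = begin
  (x + 1ℤ) ^ m - x ^ m
    ≡⟨ cong (_- x ^ m) (trans (binomial m x 1ℤ) (∑-last m (λ i → + (m C i) * (x ^ i * 1ℤ ^ (m ∸ i))))) ⟩
  (∑[ i < m ] (+ (m C i) * (x ^ i * 1ℤ ^ (m ∸ i))) + + (m C m) * (x ^ m * 1ℤ ^ (m ∸ m))) - x ^ m
    ≡⟨ cong₂ (λ s t → (s + t) - x ^ m) (∑-cong m (λ i _ → cong (λ u → + (m C i) * (x ^ i * u)) (ℤ.^-zeroˡ (m ∸ i))))
                                        (cong₂ (λ c u → + c * (x ^ m * u)) (nCn≡1 m) (ℤ.^-zeroˡ (m ∸ m))) ⟩
  (∑[ i < m ] (+ (m C i) * (x ^ i * 1ℤ)) + 1ℤ * (x ^ m * 1ℤ)) - x ^ m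
    ≡⟨ cancel (∑[ i < m ] (+ (m C i) * (x ^ i * 1ℤ))) (x ^ m) ⟩
  ∑[ i < m ] (+ (m C i) * (x ^ i * 1ℤ))
    ≡⟨ ∑-cong m (λ i _ → cong (+ (m C i) *_) (ℤ.*-identityʳ (x ^ i))) ⟩
  ∑[ i < m ] (+ (m C i) * x ^ i) ∎
  where
  open ≡-Reasoning
  cancel : ∀ s y → (s + 1ℤ * (y * 1ℤ)) - y ≡ s
  cancel = solve-∀

alternating-power : ∀ n m → m ℕ.< n → ∀ (c : ℤ) → alternating n (λ j → (+ j + c) ^ m) ≡ 0ℤ
alternating-power (suc n) m (s≤s m≤n) c = begin
  alternating (suc n) (λ j → (+ j + c) ^ m)
    ≡⟨ alternating-suc n (λ j → (+ j + c) ^ m) ⟩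
  - alternating n (Δ (λ j → (+ j + c) ^ m))
    ≡⟨ cong -_ (alternating-cong n difference) ⟩
  - alternating n (λ j → ∑[ i < m ] (+ (m C i) * (+ j + c) ^ i))
    ≡⟨ cong -_ (alternating-linear n m (λ i → + (m C i)) (λ i j → (+ j + c) ^ i)) ⟩
  - ∑[ i < m ] (+ (m C i) * alternating n (λ j → (+ j + c) ^ i))
    ≡⟨ cong -_ (∑-zero m (λ i i<m → trans (cong (+ (m C i) *_) (alternating-power n i (ℕ.<-≤-trans i<m m≤n) c))
                                           (ℤ.*-zeroʳ (+ (m C i))))) ⟩
  0ℤ ∎
  where
  open ≡-Reasoning
  difference : ∀ j → Δ (λ j → (+ j + c) ^ m) j ≡ ∑[ i < m ] (+ (m C i) * (+ j + c) ^ i)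
  difference j = trans (cong (λ x → x ^ m - (+ j + c) ^ m) (shift (+ j) c)) (power-difference m (+ j + c))
    where shift : ∀ a c → (1ℤ + a) + c ≡ (a + c) + 1ℤ
          shift = solve-∀

-- Abel's identity, by induction on n: expanding every power binomially in w
-- shows that its defect is constant in w, and at w = -(n+1) it is an alternating sum.

-- (j+1)^(j-1): j! times the j-th coefficient of P, the number of parking functions of length j.
cayley : ℕ → ℤ
cayley j = + (suc j ℕ.^ (j ∸ 1))

cayley-power : ∀ m j → j ℕ.≤ suc m → cayley j * (+ suc j) ^ (suc m ∸ j) ≡ (+ suc j) ^ m
cayley-power m zero    _ = trans (ℤ.*-identityˡ _) (trans (ℤ.^-zeroˡ (suc m)) (sym (ℤ.^-zeroˡ m)))
cayley-power m (suc j) (s≤s j≤m) = begin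
  + (suc (suc j) ℕ.^ j) * (+ suc (suc j)) ^ (m ∸ j) ≡⟨ cong (_* (+ suc (suc j)) ^ (m ∸ j)) (pos-^ (suc (suc j)) j) ⟩
  (+ suc (suc j)) ^ j * (+ suc (suc j)) ^ (m ∸ j)  ≡⟨ ℤ.^-distribˡ-+-* (+ suc (suc j)) j (m ∸ j) ⟨
  (+ suc (suc j)) ^ (j ℕ.+ (m ∸ j))                ≡⟨ cong ((+ suc (suc j)) ^_) (ℕ.m+[n∸m]≡n j≤m) ⟩
  (+ suc (suc j)) ^ m ∎
  where open ≡-Reasoning

abelSum : ℕ → ℤ → ℤ
abelSum n w = ∑[ j < suc n ] (+ (n C j) * (cayley j * (w + + (n ∸ j)) ^ (n ∸ j)))

shiftedPower : ℤ → ℕ → ℕ → ℤ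
shiftedPower w r m = w ^ r * (+ r + + m) ^ m

abelPower-expand : ∀ n (w : ℤ) j →
  (w + + (n ∸ j)) ^ (n ∸ j) ≡ ∑[ r < suc n ] (+ ((n ∸ j) C r) * shiftedPower w r (n ∸ j ∸ r))
abelPower-expand n w j = begin
  (w + + (n ∸ j)) ^ (n ∸ j)
    ≡⟨ binomial (n ∸ j) w (+ (n ∸ j)) ⟩
  ∑[ r < suc (n ∸ j) ] (+ ((n ∸ j) C r) * (w ^ r * (+ (n ∸ j)) ^ (n ∸ j ∸ r)))
    ≡⟨ ∑-C-truncate (λ r → w ^ r * (+ (n ∸ j)) ^ (n ∸ j ∸ r)) (ℕ.m∸n≤m n j) ⟨
  ∑[ r < suc n ] (+ ((n ∸ j) C r) * (w ^ r * (+ (n ∸ j)) ^ (n ∸ j ∸ r)))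
    ≡⟨ ∑-cong (suc n) (λ r _ → C-guarded (n ∸ j) r _ _ (λ r≤n-j → cong (λ b → w ^ r * b ^ (n ∸ j ∸ r)) (split r≤n-j))) ⟩
  ∑[ r < suc n ] (+ ((n ∸ j) C r) * shiftedPower w r (n ∸ j ∸ r)) ∎
  where
  open ≡-Reasoning
  split : ∀ {r} → r ℕ.≤ n ∸ j → + (n ∸ j) ≡ + r + + (n ∸ j ∸ r)
  split {r} r≤n-j = trans (cong +_ (sym (ℕ.m+[n∸m]≡n r≤n-j))) (ℤ.pos-+ r (n ∸ j ∸ r))

abelSum-expand : ∀ n (w : ℤ) → abelSum n w ≡ ∑[ r < suc n ] (+ (n C r) * (w ^ r * abelSum (n ∸ r) (+ r)))
abelSum-expand n w = begin
  abelSum n w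
    ≡⟨ ∑-cong (suc n) (λ j _ → cong (λ t → + (n C j) * (cayley j * t)) (abelPower-expand n w j)) ⟩
  ∑[ j < suc n ] (+ (n C j) * (cayley j * ∑[ r < suc n ] (+ ((n ∸ j) C r) * shiftedPower w r (n ∸ j ∸ r))))
    ≡⟨ binomial-convolution-shift n (suc n) cayley (shiftedPower w) ⟨
  ∑[ r < suc n ] (+ (n C r) * ∑[ j < suc (n ∸ r) ] (+ ((n ∸ r) C j) * (cayley j * shiftedPower w r (n ∸ r ∸ j))))
    ≡⟨ ∑-cong (suc n) (λ r _ → cong (+ (n C r) *_) (factor r)) ⟩
  ∑[ r < suc n ] (+ (n C r) * (w ^ r * abelSum (n ∸ r) (+ r))) ∎
  where
  open ≡-Reasoning
  factor : ∀ r → ∑[ j < suc (n ∸ r) ] (+ ((n ∸ r) C j) * (cayley j * shiftedPower w r (n ∸ r ∸ j)))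
                 ≡ w ^ r * abelSum (n ∸ r) (+ r)
  factor r = trans (∑-cong (suc (n ∸ r)) (λ j _ → pull (+ ((n ∸ r) C j)) (cayley j) (w ^ r) ((+ r + + (n ∸ r ∸ j)) ^ (n ∸ r ∸ j))))
                   (∑-*ˡ (suc (n ∸ r)) (w ^ r) (λ j → + ((n ∸ r) C j) * (cayley j * (+ r + + (n ∸ r ∸ j)) ^ (n ∸ r ∸ j))))
    where pull : ∀ c a x p → c * (a * (x * p)) ≡ x * (c * (a * p))
          pull = solve-∀

abelTarget-expand : ∀ n (w : ℤ) →
  (w + + suc n) ^ n ≡ ∑[ r < suc n ] (+ (n C r) * (w ^ r * (+ r + + suc (n ∸ r)) ^ (n ∸ r)))
abelTarget-expand n w = trans (binomial n w (+ suc n)) (∑-cong (suc n) split)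
  where
  split : ∀ r → r ℕ.< suc n →
          + (n C r) * (w ^ r * (+ suc n) ^ (n ∸ r)) ≡ + (n C r) * (w ^ r * (+ r + + suc (n ∸ r)) ^ (n ∸ r))
  split r (s≤s r≤n) = cong (λ b → + (n C r) * (w ^ r * b ^ (n ∸ r)))
    (trans (cong +_ (sym (trans (ℕ.+-suc r (n ∸ r)) (cong suc (ℕ.m+[n∸m]≡n r≤n))))) (ℤ.pos-+ r (suc (n ∸ r))))

abelDefect : ℕ → ℤ → ℤ
abelDefect n w = abelSum n w - (w + + suc n) ^ n

abelDefect-expand : ∀ n (w : ℤ) → abelDefect n w ≡ ∑[ r < suc n ] (+ (n C r) * (w ^ r * abelDefect (n ∸ r) (+ r)))
abelDefect-expand n w = begin
  abelSum n w - (w + + suc n) ^ n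
    ≡⟨ cong₂ _-_ (abelSum-expand n w) (abelTarget-expand n w) ⟩
  ∑[ r < suc n ] (+ (n C r) * (w ^ r * abelSum (n ∸ r) (+ r))) - ∑[ r < suc n ] (+ (n C r) * (w ^ r * (+ r + + suc (n ∸ r)) ^ (n ∸ r)))
    ≡⟨ ∑-- (suc n) (λ r → + (n C r) * (w ^ r * abelSum (n ∸ r) (+ r))) (λ r → + (n C r) * (w ^ r * (+ r + + suc (n ∸ r)) ^ (n ∸ r))) ⟨
  ∑[ r < suc n ] (+ (n C r) * (w ^ r * abelSum (n ∸ r) (+ r)) - + (n C r) * (w ^ r * (+ r + + suc (n ∸ r)) ^ (n ∸ r)))
    ≡⟨ ∑-cong (suc n) (λ r _ → factor (+ (n C r)) (w ^ r) (abelSum (n ∸ r) (+ r)) ((+ r + + suc (n ∸ r)) ^ (n ∸ r))) ⟩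
  ∑[ r < suc n ] (+ (n C r) * (w ^ r * abelDefect (n ∸ r) (+ r))) ∎
  where
  open ≡-Reasoning
  factor : ∀ c u a b → c * (u * a) - c * (u * b) ≡ c * (u * (a - b))
  factor = solve-∀

abelDefect-constant : ∀ n → (∀ {m} → m ℕ.< n → ∀ w → abelDefect m w ≡ 0ℤ) → ∀ w → abelDefect n w ≡ abelDefect n 0ℤ
abelDefect-constant zero    _  w = refl
abelDefect-constant (suc m) IH w = begin
  abelDefect (suc m) w
    ≡⟨ abelDefect-expand (suc m) w ⟩
  1ℤ * (1ℤ * abelDefect (suc m) 0ℤ) + ∑[ r < suc m ] (+ (suc m C suc r) * (w ^ suc r * abelDefect (m ∸ r) (+ suc r)))
    ≡⟨ cong (λ t → 1ℤ * (1ℤ * abelDefect (suc m) 0ℤ) + t) (∑-zero (suc m) higher) ⟩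
  1ℤ * (1ℤ * abelDefect (suc m) 0ℤ) + 0ℤ
    ≡⟨ unit (abelDefect (suc m) 0ℤ) ⟩
  abelDefect (suc m) 0ℤ ∎
  where
  open ≡-Reasoning
  higher : ∀ r → r ℕ.< suc m → + (suc m C suc r) * (w ^ suc r * abelDefect (m ∸ r) (+ suc r)) ≡ 0ℤ
  higher r _ = trans (cong (λ d → + (suc m C suc r) * (w ^ suc r * d)) (IH (s≤s (ℕ.m∸n≤m m r)) (+ suc r)))
                     (annihilate (+ (suc m C suc r)) (w ^ suc r))
    where annihilate : ∀ a b → a * (b * 0ℤ) ≡ 0ℤ
          annihilate = solve-∀
  unit : ∀ a → 1ℤ * (1ℤ * a) + 0ℤ ≡ a
  unit = solve-∀

abelTerm-at-root : ∀ m j → let n = suc m in j ℕ.≤ n →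
  + (n C j) * (cayley j * (- + suc n + + (n ∸ j)) ^ (n ∸ j)) ≡ sgn n * (+ (n C j) * (sgn j * (+ j + 1ℤ) ^ m))
abelTerm-at-root m j j≤n = begin
  + (n C j) * (cayley j * (- + suc n + + (n ∸ j)) ^ (n ∸ j))
    ≡⟨ cong (λ b → + (n C j) * (cayley j * b ^ (n ∸ j))) base ⟩
  + (n C j) * (cayley j * (-1ℤ * + suc j) ^ (n ∸ j))
    ≡⟨ cong (λ t → + (n C j) * (cayley j * t)) (^-distrib-* -1ℤ (+ suc j) (n ∸ j)) ⟩
  + (n C j) * (cayley j * (sgn (n ∸ j) * (+ suc j) ^ (n ∸ j)))
    ≡⟨ swap (+ (n C j)) (cayley j) (sgn (n ∸ j)) _ ⟩
  + (n C j) * (sgn (n ∸ j) * (cayley j * (+ suc j) ^ (n ∸ j)))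
    ≡⟨ cong₂ (λ s p → + (n C j) * (s * p)) (sgn-∸ j≤n) (cayley-power m j j≤n) ⟩
  + (n C j) * ((sgn n * sgn j) * (+ suc j) ^ m)
    ≡⟨ cong (λ b → + (n C j) * ((sgn n * sgn j) * b ^ m)) (cong +_ (ℕ.+-comm 1 j)) ⟩
  + (n C j) * ((sgn n * sgn j) * (+ j + 1ℤ) ^ m)
    ≡⟨ pull (+ (n C j)) (sgn n) (sgn j) _ ⟩
  sgn n * (+ (n C j) * (sgn j * (+ j + 1ℤ) ^ m)) ∎
  where
  open ≡-Reasoning
  n = suc m
  base : - + suc n + + (n ∸ j) ≡ -1ℤ * + suc j
  base = trans (cong (λ t → - t + + (n ∸ j)) (trans (cong (λ t → + suc t) (sym (ℕ.m+[n∸m]≡n j≤n))) (ℤ.pos-+ (suc j) (n ∸ j))))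
               (cancel (+ suc j) (+ (n ∸ j)))
    where cancel : ∀ a b → - (a + b) + b ≡ -1ℤ * a
          cancel = solve-∀
  swap : ∀ a b c d → a * (b * (c * d)) ≡ a * (c * (b * d))
  swap = solve-∀
  pull : ∀ a b c d → a * ((b * c) * d) ≡ b * (a * (c * d))
  pull = solve-∀

-- Hence A_n(-(n+1)) is (-1)^n times an alternating sum of (j+1)^(n-1), which vanishes.
abelSum-at-root : ∀ m → abelSum (suc m) (- + suc (suc m)) ≡ 0ℤ
abelSum-at-root m = begin
  abelSum (suc m) (- + suc (suc m))
    ≡⟨ ∑-cong (suc (suc m)) (λ j j≤n → abelTerm-at-root m j (ℕ.≤-pred j≤n)) ⟩
  ∑[ j < suc (suc m) ] (sgn (suc m) * (+ (suc m C j) * (sgn j * (+ j + 1ℤ) ^ m)))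
    ≡⟨ ∑-*ˡ (suc (suc m)) (sgn (suc m)) (λ j → + (suc m C j) * (sgn j * (+ j + 1ℤ) ^ m)) ⟩
  sgn (suc m) * alternating (suc m) (λ j → (+ j + 1ℤ) ^ m)
    ≡⟨ cong (sgn (suc m) *_) (alternating-power (suc m) m ℕ.≤-refl 1ℤ) ⟩
  sgn (suc m) * 0ℤ
    ≡⟨ ℤ.*-zeroʳ (sgn (suc m)) ⟩
  0ℤ ∎
  where open ≡-Reasoning

abelDefect-vanishes : ∀ n w → abelDefect n w ≡ 0ℤ
abelDefect-vanishes = <-rec (λ n → ∀ w → abelDefect n w ≡ 0ℤ) step
  where
  step : ∀ n → (∀ {m} → m ℕ.< n → ∀ w → abelDefect m w ≡ 0ℤ) → ∀ w → abelDefect n w ≡ 0ℤ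
  step zero    _  w = refl
  step (suc m) IH w = begin
    abelDefect (suc m) w                  ≡⟨ abelDefect-constant (suc m) IH w ⟩
    abelDefect (suc m) 0ℤ                 ≡⟨ abelDefect-constant (suc m) IH (- + suc (suc m)) ⟨
    abelDefect (suc m) (- + suc (suc m))  ≡⟨ cong₂ _-_ (abelSum-at-root m) (cong (_^ suc m) (ℤ.+-inverseˡ (+ suc (suc m)))) ⟩
    0ℤ ∎
    where open ≡-Reasoning

abel : ∀ n (w : ℤ) → abelSum n w ≡ (w + + suc n) ^ n
abel n w = ℤ.i-j≡0⇒i≡j _ _ (abelDefect-vanishes n w)

-- The closed form P A_k - B_k, coefficientwise.

signedPow-neg : ∀ i m → signedPow i m ≡ (- + m) ^ i
signedPow-neg i m = begin
  sgn i * + (m ℕ.^ i)       ≡⟨ cong (sgn i *_) (pos-^ m i) ⟩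
  sgn i * (+ m) ^ i         ≡⟨ ^-distrib-* -1ℤ (+ m) i ⟨
  (-1ℤ * + m) ^ i           ≡⟨ cong (_^ i) (ℤ.-1*i≡-i (+ m)) ⟩
  (- + m) ^ i ∎
  where open ≡-Reasoning

signedPow-vanish : ∀ i → 1 ℕ.≤ i → signedPow i 0 ≡ 0ℤ
signedPow-vanish (suc i) _ = ℤ.*-zeroʳ (sgn (suc i))

-- Σ_i C(M,i) (-(c+1))^(M-i) = (1 - (c+1))^M = (-c)^M
signedPow-binomial : ∀ M c → ∑[ i < suc M ] (+ (M C i) * signedPow (M ∸ i) (suc c)) ≡ signedPow M c
signedPow-binomial M c = begin
  ∑[ i < suc M ] (+ (M C i) * signedPow (M ∸ i) (suc c))
    ≡⟨ ∑-cong (suc M) (λ i _ → trans (cong (+ (M C i) *_) (sym (ℤ.*-identityˡ _)))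
                                     (cong₂ (λ u v → + (M C i) * (u * v)) (sym (ℤ.^-zeroˡ i)) (signedPow-neg (M ∸ i) (suc c)))) ⟩
  ∑[ i < suc M ] (+ (M C i) * (1ℤ ^ i * (- + suc c) ^ (M ∸ i)))
    ≡⟨ binomial M 1ℤ (- + suc c) ⟨
  (1ℤ + - + suc c) ^ M
    ≡⟨ cong (_^ M) (shift (+ c)) ⟩
  (- + c) ^ M
    ≡⟨ signedPow-neg M c ⟨
  signedPow M c ∎
  where
  open ≡-Reasoning
  shift : ∀ a → 1ℤ + - (1ℤ + a) ≡ - a
  shift = solve-∀

-- m! times the coefficient of x^m in A_k(x) = Σ_{i≤k} (-1)^i (k+1-i)^i x^i/i!.
-- For m > k the formula gives (-1)^m 0^m = 0, so no truncation is needed.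
A-coeff : ℕ → ℕ → ℤ
A-coeff k m = signedPow m (suc k ∸ m)

-- m! times the coefficient of x^m in B_k(x) = Σ_{i<k} (-1)^i (k-i)^i x^i/i!.
B-coeff : ℕ → ℕ → ℤ
B-coeff k m = if suc m ≤ᵇ k then signedPow m (k ∸ m) else 0ℤ

A-coeff-above : ∀ {k m} → k ℕ.< m → A-coeff k m ≡ 0ℤ
A-coeff-above {k} {m} k<m =
  trans (cong (signedPow m) (ℕ.m≤n⇒m∸n≡0 k<m)) (signedPow-vanish m (ℕ.≤-trans (s≤s z≤n) k<m))

B-coeff-below : ∀ {k m} → m ℕ.< k → B-coeff k m ≡ signedPow m (k ∸ m)
B-coeff-below = if-≤ᵇ-true

B-coeff-above : ∀ {k m} → ¬ m ℕ.< k → B-coeff k m ≡ 0ℤ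
B-coeff-above {k} {m} = if-≤ᵇ-false {a = signedPow m (k ∸ m)}

-- n! times the coefficients of x^n in P(x) A_k(x) and in P(x) A_k(x) - B_k(x).
PA-coeff : ℕ → ℕ → ℤ
PA-coeff n k = ∑[ j < suc n ] (+ (n C j) * (cayley j * A-coeff k (n ∸ j)))

closedForm : ℕ → ℕ → ℤ
closedForm n k = PA-coeff n k - B-coeff k n

-- Both coefficient sequences satisfy the recurrence of R_k (in the form
-- Σ_{i ≤ k+1} C(n,i) c_{k+1-i}(n-i) = c_k(n)), by the binomial theorem.
A-coeff-rec : ∀ M k → ∑[ i < suc (suc k) ] (+ (M C i) * A-coeff (suc k ∸ i) (M ∸ i)) ≡ A-coeff k M
A-coeff-rec M k with M ℕ.≤? suc k
... | yes M≤k+1 = begin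
  ∑[ i < suc (suc k) ] (+ (M C i) * A-coeff (suc k ∸ i) (M ∸ i))
    ≡⟨ ∑-C-truncate (λ i → A-coeff (suc k ∸ i) (M ∸ i)) M≤k+1 ⟩
  ∑[ i < suc M ] (+ (M C i) * A-coeff (suc k ∸ i) (M ∸ i))
    ≡⟨ ∑-cong (suc M) (λ i i≤M → cong (λ e → + (M C i) * signedPow (M ∸ i) e) (exponent i (ℕ.≤-pred i≤M))) ⟩
  ∑[ i < suc M ] (+ (M C i) * signedPow (M ∸ i) (suc (suc k ∸ M)))
    ≡⟨ signedPow-binomial M (suc k ∸ M) ⟩
  A-coeff k M ∎
  where
  open ≡-Reasoning
  exponent : ∀ i → i ℕ.≤ M → suc (suc k ∸ i) ∸ (M ∸ i) ≡ suc (suc k ∸ M)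
  exponent i i≤M = begin
    suc (suc k ∸ i) ∸ (M ∸ i) ≡⟨ cong (_∸ (M ∸ i)) (ℕ.+-∸-assoc 1 (ℕ.≤-trans i≤M M≤k+1)) ⟨
    suc (suc k) ∸ i ∸ (M ∸ i) ≡⟨ ℕ.∸-+-assoc (suc (suc k)) i (M ∸ i) ⟩
    suc (suc k) ∸ (i ℕ.+ (M ∸ i)) ≡⟨ cong (suc (suc k) ∸_) (ℕ.m+[n∸m]≡n i≤M) ⟩
    suc (suc k) ∸ M ≡⟨ ℕ.+-∸-assoc 1 M≤k+1 ⟩
    suc (suc k ∸ M) ∎
... | no M≰k+1 = begin
  ∑[ i < suc (suc k) ] (+ (M C i) * A-coeff (suc k ∸ i) (M ∸ i))
    ≡⟨ ∑-zero (suc (suc k)) (λ i i<k+2 → vanish i (ℕ.≤-pred i<k+2)) ⟩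
  0ℤ
    ≡⟨ A-coeff-above (ℕ.<⇒≤ k+1<M) ⟨
  A-coeff k M ∎
  where
  open ≡-Reasoning
  k+1<M = ℕ.≰⇒> M≰k+1
  vanish : ∀ i → i ℕ.≤ suc k → + (M C i) * A-coeff (suc k ∸ i) (M ∸ i) ≡ 0ℤ
  vanish i i≤k+1 = trans (cong (+ (M C i) *_) (A-coeff-above gap)) (ℤ.*-zeroʳ (+ (M C i)))
    where gap : suc k ∸ i ℕ.< M ∸ i
          gap = subst (ℕ._≤ M ∸ i) (ℕ.+-∸-assoc 1 i≤k+1) (ℕ.∸-monoˡ-≤ i k+1<M)

B-coeff-shift : ∀ {n k i} → i ℕ.≤ n → n ℕ.≤ k → B-coeff (suc k ∸ i) (n ∸ i) ≡ signedPow (n ∸ i) (suc (k ∸ n))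
B-coeff-shift {n} {k} {i} i≤n n≤k =
  trans (B-coeff-below (subst (suc (n ∸ i) ℕ.≤_) (sym k+1-i) (s≤s (ℕ.∸-monoˡ-≤ i n≤k))))
        (cong (signedPow (n ∸ i)) exponent)
  where
  k+1-i : suc k ∸ i ≡ suc (k ∸ i)
  k+1-i = ℕ.+-∸-assoc 1 (ℕ.≤-trans i≤n n≤k)
  exponent : suc k ∸ i ∸ (n ∸ i) ≡ suc (k ∸ n)
  exponent = trans (ℕ.∸-+-assoc (suc k) i (n ∸ i)) (trans (cong (suc k ∸_) (ℕ.m+[n∸m]≡n i≤n)) (ℕ.+-∸-assoc 1 n≤k))

B-coeff-diagonal : ∀ {n k} → 1 ℕ.≤ k ⊎ k ℕ.< n → n ℕ.≤ k → signedPow n (k ∸ n) ≡ B-coeff k n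
B-coeff-diagonal {n} {k} side n≤k with ℕ.m≤n⇒m<n∨m≡n n≤k
... | inj₁ n<k  = sym (B-coeff-below n<k)
... | inj₂ refl = trans (cong (signedPow n) (ℕ.n∸n≡0 n))
                        (trans (signedPow-vanish n (positive side)) (sym (B-coeff-above {n} {n} (ℕ.<-irrefl refl))))
  where positive : 1 ℕ.≤ n ⊎ n ℕ.< n → 1 ℕ.≤ n
        positive (inj₁ 1≤n) = 1≤n
        positive (inj₂ n<n) = ⊥-elim (ℕ.<-irrefl refl n<n)

B-coeff-rec : ∀ n k → 1 ℕ.≤ k ⊎ k ℕ.< n →
              ∑[ i < suc (suc k) ] (+ (n C i) * B-coeff (suc k ∸ i) (n ∸ i)) ≡ B-coeff k n
B-coeff-rec n k side with n ℕ.≤? k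
... | yes n≤k = begin
  ∑[ i < suc (suc k) ] (+ (n C i) * B-coeff (suc k ∸ i) (n ∸ i))
    ≡⟨ ∑-C-truncate (λ i → B-coeff (suc k ∸ i) (n ∸ i)) (ℕ.m≤n⇒m≤1+n n≤k) ⟩
  ∑[ i < suc n ] (+ (n C i) * B-coeff (suc k ∸ i) (n ∸ i))
    ≡⟨ ∑-cong (suc n) (λ i i≤n → cong (+ (n C i) *_) (B-coeff-shift (ℕ.≤-pred i≤n) n≤k)) ⟩
  ∑[ i < suc n ] (+ (n C i) * signedPow (n ∸ i) (suc (k ∸ n)))
    ≡⟨ signedPow-binomial n (k ∸ n) ⟩
  signedPow n (k ∸ n)
    ≡⟨ B-coeff-diagonal side n≤k ⟩
  B-coeff k n ∎
  where open ≡-Reasoning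
... | no n≰k = begin
  ∑[ i < suc (suc k) ] (+ (n C i) * B-coeff (suc k ∸ i) (n ∸ i))
    ≡⟨ ∑-zero (suc (suc k)) (λ i _ → trans (cong (+ (n C i) *_) (B-coeff-above (above i))) (ℤ.*-zeroʳ (+ (n C i)))) ⟩
  0ℤ
    ≡⟨ B-coeff-above (λ n<k → n≰k (ℕ.<⇒≤ n<k)) ⟨
  B-coeff k n ∎
  where
  open ≡-Reasoning
  above : ∀ i → ¬ n ∸ i ℕ.< suc k ∸ i
  above i = ℕ.<⇒≱ (s≤s (ℕ.∸-monoˡ-≤ i (ℕ.≰⇒> n≰k)))

PA-coeff-rec : ∀ n k → ∑[ i < suc (suc k) ] (+ (n C i) * PA-coeff (n ∸ i) (suc k ∸ i)) ≡ PA-coeff n k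
PA-coeff-rec n k = begin
  ∑[ i < suc (suc k) ] (+ (n C i) * PA-coeff (n ∸ i) (suc k ∸ i))
    ≡⟨ binomial-convolution-shift n (suc (suc k)) cayley (λ i m → A-coeff (suc k ∸ i) m) ⟩
  ∑[ j < suc n ] (+ (n C j) * (cayley j * ∑[ i < suc (suc k) ] (+ ((n ∸ j) C i) * A-coeff (suc k ∸ i) (n ∸ j ∸ i))))
    ≡⟨ ∑-cong (suc n) (λ j _ → cong (λ t → + (n C j) * (cayley j * t)) (A-coeff-rec (n ∸ j) k)) ⟩
  PA-coeff n k ∎
  where open ≡-Reasoning

closedForm-rec : ∀ n k → 1 ℕ.≤ k ⊎ k ℕ.< n →
                 ∑[ i < suc (suc k) ] (+ (n C i) * closedForm (n ∸ i) (suc k ∸ i)) ≡ closedForm n k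
closedForm-rec n k side = begin
  ∑[ i < suc (suc k) ] (+ (n C i) * closedForm (n ∸ i) (suc k ∸ i))
    ≡⟨ ∑-cong (suc (suc k)) (λ i _ → distrib (+ (n C i)) (PA-coeff (n ∸ i) (suc k ∸ i)) (B-coeff (suc k ∸ i) (n ∸ i))) ⟩
  ∑[ i < suc (suc k) ] (+ (n C i) * PA-coeff (n ∸ i) (suc k ∸ i) - + (n C i) * B-coeff (suc k ∸ i) (n ∸ i))
    ≡⟨ ∑-- (suc (suc k)) (λ i → + (n C i) * PA-coeff (n ∸ i) (suc k ∸ i)) (λ i → + (n C i) * B-coeff (suc k ∸ i) (n ∸ i)) ⟩
  ∑[ i < suc (suc k) ] (+ (n C i) * PA-coeff (n ∸ i) (suc k ∸ i)) - ∑[ i < suc (suc k) ] (+ (n C i) * B-coeff (suc k ∸ i) (n ∸ i))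
    ≡⟨ cong₂ _-_ (PA-coeff-rec n k) (B-coeff-rec n k side) ⟩
  closedForm n k ∎
  where
  open ≡-Reasoning
  distrib : ∀ c a b → c * (a - b) ≡ c * a - c * b
  distrib = solve-∀

signedPow-shift : ∀ i m K → m ℕ.≤ K → signedPow i (K ∸ m) ≡ (- + K + + m) ^ i
signedPow-shift i m K m≤K = trans (signedPow-neg i (K ∸ m)) (cong (_^ i) (sym (begin
  - + K + + m               ≡⟨ cong (λ t → - t + + m) (trans (cong +_ (sym (ℕ.m∸n+n≡m m≤K))) (ℤ.pos-+ (K ∸ m) m)) ⟩
  - (+ (K ∸ m) + + m) + + m ≡⟨ cancel (+ (K ∸ m)) (+ m) ⟩
  - + (K ∸ m) ∎)))
  where
  open ≡-Reasoning
  cancel : ∀ a b → - (a + b) + b ≡ - a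
  cancel = solve-∀

-- On and above the diagonal, P A_k is evaluated by Abel's identity at w = -(k+1).
PA-coeff-diagonal : ∀ n k → n ℕ.≤ k → PA-coeff n k ≡ signedPow n (k ∸ n)
PA-coeff-diagonal n k n≤k = begin
  PA-coeff n k
    ≡⟨ ∑-cong (suc n) (λ j _ → cong (λ t → + (n C j) * (cayley j * t))
                                  (signedPow-shift (n ∸ j) (n ∸ j) (suc k) (ℕ.≤-trans (ℕ.m∸n≤m n j) (ℕ.m≤n⇒m≤1+n n≤k)))) ⟩
  abelSum n (- + suc k)
    ≡⟨ abel n (- + suc k) ⟩
  (- + suc k + + suc n) ^ n
    ≡⟨ signedPow-shift n (suc n) (suc k) (s≤s n≤k) ⟨
  signedPow n (k ∸ n) ∎
  where open ≡-Reasoning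

δ : ℕ → ℕ → ℤ
δ zero    zero    = 1ℤ
δ zero    (suc _) = 0ℤ
δ (suc _) _       = 0ℤ

δ-off-diagonal : ∀ {n k} → n ℕ.< k → δ n k ≡ 0ℤ
δ-off-diagonal {zero}  {suc k} _ = refl
δ-off-diagonal {suc n}         _ = refl

closedForm-boundary : ∀ n k → n ℕ.≤ k → closedForm n k ≡ δ n k
closedForm-boundary n k n≤k with ℕ.m≤n⇒m<n∨m≡n n≤k
... | inj₁ n<k = begin
  PA-coeff n k - B-coeff k n                   ≡⟨ cong₂ _-_ (PA-coeff-diagonal n k n≤k) (B-coeff-below n<k) ⟩
  signedPow n (k ∸ n) - signedPow n (k ∸ n)    ≡⟨ ℤ.+-inverseʳ (signedPow n (k ∸ n)) ⟩
  0ℤ                                           ≡⟨ δ-off-diagonal n<k ⟨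
  δ n k ∎
  where open ≡-Reasoning
... | inj₂ refl = begin
  PA-coeff n n - B-coeff n n          ≡⟨ cong₂ _-_ (PA-coeff-diagonal n n n≤k) (B-coeff-above {n} {n} (ℕ.<-irrefl refl)) ⟩
  signedPow n (n ∸ n) - 0ℤ            ≡⟨ trans (ℤ.+-identityʳ _) (cong (signedPow n) (ℕ.n∸n≡0 n)) ⟩
  signedPow n 0                       ≡⟨ diagonal n ⟩
  δ n n ∎
  where
  open ≡-Reasoning
  diagonal : ∀ n → signedPow n 0 ≡ δ n n
  diagonal zero    = refl
  diagonal (suc n) = signedPow-vanish (suc n) (s≤s z≤n)

-- For k = 0 only the term j = n of P A_0 survives.
closedForm-zero : ∀ n → closedForm n 0 ≡ cayley n
closedForm-zero n = begin
  PA-coeff n 0 - 0ℤ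
    ≡⟨ ℤ.+-identityʳ _ ⟩
  PA-coeff n 0
    ≡⟨ ∑-single (suc n) n _ ℕ.≤-refl vanish ⟩
  + (n C n) * (cayley n * signedPow (n ∸ n) (1 ∸ (n ∸ n)))
    ≡⟨ cong₂ (λ c e → + c * (cayley n * signedPow e (1 ∸ e))) (nCn≡1 n) (ℕ.n∸n≡0 n) ⟩
  1ℤ * (cayley n * 1ℤ)
    ≡⟨ unit (cayley n) ⟩
  cayley n ∎
  where
  open ≡-Reasoning
  unit : ∀ a → 1ℤ * (a * 1ℤ) ≡ a
  unit = solve-∀
  vanish : ∀ j → j ℕ.< suc n → j ≢ n → + (n C j) * (cayley j * A-coeff 0 (n ∸ j)) ≡ 0ℤ
  vanish j (s≤s j≤n) j≢n = trans (cong (λ t → + (n C j) * (cayley j * t)) (A-coeff-above (ℕ.m<n⇒0<n∸m (ℕ.≤∧≢⇒< j≤n j≢n))))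
                                 (annihilate (+ (n C j)) (cayley j))
    where
    annihilate : ∀ a b → a * (b * 0ℤ) ≡ 0ℤ
    annihilate = solve-∀

-- Parking functions.

free : List Bool → ℕ
free []           = 0
free (false ∷ st) = suc (free st)
free (true ∷ st)  = free st

freeAfter : ℕ → List Bool → ℕ
freeAfter j st = free (drop j st)

freeAfter-empty : ∀ n j → freeAfter j (replicate n false) ≡ n ∸ j
freeAfter-empty n       zero    = count n
  where count : ∀ n → free (replicate n false) ≡ n
        count zero    = refl
        count (suc n) = cong suc (count n)
freeAfter-empty zero    (suc j) = refl
freeAfter-empty (suc n) (suc j) = freeAfter-empty n j

indicator : Bool → ℕ
indicator true  = 1
indicator false = 0

carsAfter : ℕ → List ℕ → ℕ
carsAfter j []       = 0
carsAfter j (a ∷ as) = indicator (j <ᵇ a) ℕ.+ carsAfter j as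

carsAfter-antitone : ∀ j as → carsAfter (suc j) as ℕ.≤ carsAfter j as
carsAfter-antitone j []       = z≤n
carsAfter-antitone j (a ∷ as) = ℕ.+-mono-≤ (step j a) (carsAfter-antitone j as)
  where
  step : ∀ j a → indicator (suc j <ᵇ a) ℕ.≤ indicator (j <ᵇ a)
  step j       zero          = z≤n
  step zero    (suc zero)    = z≤n
  step zero    (suc (suc a)) = s≤s z≤n
  step (suc j) (suc a)       = step j a

park-uses-one : ∀ a st st' → parkAt a st ≡ just st' → suc (free st') ≡ free st
park-uses-one a [] st' ()
park-uses-one (suc (suc a)) (b ∷ bs) st' eq with parkAt (suc a) bs in e
park-uses-one (suc (suc a)) (false ∷ bs) .(false ∷ st) refl | just st = cong suc (park-uses-one (suc a) bs st e)
park-uses-one (suc (suc a)) (true ∷ bs)  .(true ∷ st)  refl | just st = park-uses-one (suc a) bs st e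
park-uses-one zero          (false ∷ bs) .(true ∷ bs) refl = refl
park-uses-one (suc zero)    (false ∷ bs) .(true ∷ bs) refl = refl
park-uses-one zero          (true ∷ bs) st' eq with parkAt 1 bs in e
park-uses-one zero          (true ∷ bs) .(true ∷ st) refl | just st = park-uses-one 1 bs st e
park-uses-one (suc zero)    (true ∷ bs) st' eq with parkAt 1 bs in e
park-uses-one (suc zero)    (true ∷ bs) .(true ∷ st) refl | just st = park-uses-one 1 bs st e

park-after : ∀ a st st' → parkAt (suc a) st ≡ just st' →
             ∀ j → indicator (j <ᵇ suc a) ℕ.+ freeAfter j st' ℕ.≤ freeAfter j st
park-after a [] st' ()
park-after zero (false ∷ bs) .(true ∷ bs) refl zero    = ℕ.≤-refl
park-after zero (false ∷ bs) .(true ∷ bs) refl (suc j) = ℕ.≤-refl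
park-after zero (true ∷ bs) st' eq j with parkAt 1 bs in e
park-after zero (true ∷ bs) .(true ∷ st) refl zero    | just st = ℕ.≤-reflexive (park-uses-one 1 bs st e)
park-after zero (true ∷ bs) .(true ∷ st) refl (suc j) | just st =
  ℕ.m+n≤o⇒n≤o (indicator (j <ᵇ 1)) (park-after zero bs st e j)
park-after (suc a) (b ∷ bs) st' eq j with parkAt (suc a) bs in e
park-after (suc a) (false ∷ bs) .(false ∷ st) refl zero    | just st = s≤s (ℕ.≤-reflexive (park-uses-one (suc a) bs st e))
park-after (suc a) (true ∷ bs)  .(true ∷ st)  refl zero    | just st = ℕ.≤-reflexive (park-uses-one (suc a) bs st e)
park-after (suc a) (false ∷ bs) .(false ∷ st) refl (suc j) | just st = park-after a bs st e j
park-after (suc a) (true ∷ bs)  .(true ∷ st)  refl (suc j) | just st = park-after a bs st e j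

park-succeeds : ∀ a st (C : ℕ → ℕ) → (∀ j → C (suc j) ℕ.≤ C j) →
                (∀ j → indicator (j <ᵇ suc a) ℕ.+ C j ℕ.≤ freeAfter j st) →
                Σ[ st' ∈ List Bool ] (parkAt (suc a) st ≡ just st' × (∀ j → C j ℕ.≤ freeAfter j st'))
park-succeeds a [] C antitone room with room 0
... | ()
park-succeeds zero (false ∷ bs) C antitone room = true ∷ bs , refl , fits
  where
  fits : ∀ j → C j ℕ.≤ freeAfter j (true ∷ bs)
  fits zero    = ℕ.≤-pred (room 0)
  fits (suc j) = room (suc j)
park-succeeds zero (true ∷ bs) C antitone room
  with park-succeeds zero bs (λ j → C (suc j)) (λ j → antitone (suc j)) room′
  where
  room′ : ∀ j → indicator (j <ᵇ 1) ℕ.+ C (suc j) ℕ.≤ freeAfter j bs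
  room′ zero    = ℕ.≤-trans (s≤s (antitone 0)) (room 0)
  room′ (suc j) = room (suc (suc j))
... | st , parks , fits = true ∷ st , cong (Maybe.map (true ∷_)) parks , fits′
  where
  fits′ : ∀ j → C j ℕ.≤ freeAfter j (true ∷ st)
  fits′ zero    = ℕ.≤-pred (subst (suc (C 0) ℕ.≤_) (sym (park-uses-one 1 bs st parks)) (room 0))
  fits′ (suc j) = fits j
park-succeeds (suc a) (b ∷ bs) C antitone room
  with park-succeeds a bs (λ j → C (suc j)) (λ j → antitone (suc j)) (λ j → room (suc j))
... | st , parks , fits = b ∷ st , cong (Maybe.map (b ∷_)) parks , fits′
  where
  fits′ : ∀ j → C j ℕ.≤ freeAfter j (b ∷ st)
  fits′ (suc j) = fits j
  fits′ zero    = first b (park-uses-one (suc a) bs st parks) (room 0)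
    where
    first : ∀ b → suc (free st) ≡ free bs → suc (C 0) ℕ.≤ free (b ∷ bs) → C 0 ℕ.≤ free (b ∷ st)
    first false used r = subst (C 0 ℕ.≤_) (sym used) (ℕ.≤-pred r)
    first true  used r = ℕ.≤-pred (subst (suc (C 0) ℕ.≤_) (sym used) r)

Positive : List ℕ → Set
Positive = All (1 ℕ.≤_)

allPark-complete : ∀ as st → Positive as → T (allPark as st) → ∀ j → carsAfter j as ℕ.≤ freeAfter j st
allPark-complete []             st _ _ j = z≤n
allPark-complete (suc a ∷ as) st (_ ∷ pos) parks j with parkAt (suc a) st in e
... | just st' = ℕ.≤-trans (ℕ.+-monoʳ-≤ (indicator (j <ᵇ suc a)) (allPark-complete as st' pos parks j))
                           (park-after a st st' e j)

allPark-sound : ∀ as st → Positive as → (∀ j → carsAfter j as ℕ.≤ freeAfter j st) → T (allPark as st)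
allPark-sound []             st _ _ = _
allPark-sound (suc a ∷ as) st (_ ∷ pos) room
  with park-succeeds a st (λ j → carsAfter j as) (λ j → carsAfter-antitone j as) room
... | st' , parks , fits rewrite parks = allPark-sound as st' pos fits

parkingFunction⇒counts : ∀ n as → Positive as → T (isParkingFunction n as) → ∀ j → carsAfter j as ℕ.≤ n ∸ j
parkingFunction⇒counts n as pos pf j =
  subst (carsAfter j as ℕ.≤_) (freeAfter-empty n j) (allPark-complete as (replicate n false) pos pf j)

counts⇒parkingFunction : ∀ n as → Positive as → (∀ j → carsAfter j as ℕ.≤ n ∸ j) → T (isParkingFunction n as)
counts⇒parkingFunction n as pos counts =
  allPark-sound as (replicate n false) pos (λ j → subst (carsAfter j as ℕ.≤_) (sym (freeAfter-empty n j)) (counts j))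

without : ℕ → List ℕ → List ℕ
without s []       = []
without s (a ∷ as) = if a ≡ᵇ s then without s as else a ∷ without s as

multiplicity : ℕ → List ℕ → ℕ
multiplicity s []       = 0
multiplicity s (a ∷ as) = if a ≡ᵇ s then suc (multiplicity s as) else multiplicity s as

InRange : ℕ → List ℕ → Set
InRange s = All (λ a → 1 ℕ.≤ a × a ℕ.≤ s)

inRange⇒positive : ∀ {s} as → InRange s as → Positive as
inRange⇒positive []       []                  = []
inRange⇒positive (a ∷ as) ((1≤a , _) ∷ range) = 1≤a ∷ inRange⇒positive as range

without-positive : ∀ s as → InRange s as → Positive (without s as)
without-positive s []       []                  = []
without-positive s (a ∷ as) ((1≤a , _) ∷ range) with a ≡ᵇ s
... | true  = without-positive s as range
... | false = 1≤a ∷ without-positive s as range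

carsAfter-split : ∀ s j as → j ℕ.< s → carsAfter j as ≡ carsAfter j (without s as) ℕ.+ multiplicity s as
carsAfter-split s j []       _   = refl
carsAfter-split s j (a ∷ as) j<s with a ≡ᵇ s in e
... | true  = begin
  indicator (j <ᵇ a) ℕ.+ carsAfter j as
    ≡⟨ cong₂ ℕ._+_ (cong (λ b → indicator (j <ᵇ b)) (≡ᵇ-true {a} {s} e)) (carsAfter-split s j as j<s) ⟩
  indicator (j <ᵇ s) ℕ.+ (carsAfter j (without s as) ℕ.+ multiplicity s as)
    ≡⟨ cong (λ b → indicator b ℕ.+ (carsAfter j (without s as) ℕ.+ multiplicity s as)) (isTrue (ℕ.<⇒<ᵇ j<s)) ⟩
  suc (carsAfter j (without s as) ℕ.+ multiplicity s as)
    ≡⟨ ℕ.+-suc _ _ ⟨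
  carsAfter j (without s as) ℕ.+ suc (multiplicity s as) ∎
  where
  open ≡-Reasoning
  isTrue : ∀ {b} → T b → b ≡ true
  isTrue {true} _ = refl
... | false = trans (cong (indicator (j <ᵇ a) ℕ.+_) (carsAfter-split s j as j<s))
                    (sym (ℕ.+-assoc (indicator (j <ᵇ a)) _ _))

carsAfter-beyond : ∀ s as → InRange s as → ∀ j → s ℕ.≤ j → carsAfter j as ≡ 0
carsAfter-beyond s []       []                  j _   = refl
carsAfter-beyond s (a ∷ as) ((_ , a≤s) ∷ range) j s≤j =
  cong₂ ℕ._+_ (cong indicator (<ᵇ-false (ℕ.≤-trans a≤s s≤j))) (carsAfter-beyond s as range j s≤j)

carsAfter-without : ∀ s as → InRange s as → ∀ j → s ℕ.≤ suc j → carsAfter j (without s as) ≡ 0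
carsAfter-without s []       []                  j _ = refl
carsAfter-without s (a ∷ as) ((_ , a≤s) ∷ range) j s≤j+1 with a ≡ᵇ s in e
... | true  = carsAfter-without s as range j s≤j+1
... | false = cong₂ ℕ._+_ (cong indicator (<ᵇ-false a≤j)) (carsAfter-without s as range j s≤j+1)
  where
  true≢false : true ≢ false
  true≢false ()
  a≢s : a ≢ s
  a≢s a≡s = true≢false (trans (sym (≡ᵇ-refl s)) (subst (λ b → (b ≡ᵇ s) ≡ false) a≡s e))
  a≤j : a ℕ.≤ j
  a≤j = ℕ.≤-pred (ℕ.≤-trans (ℕ.≤∧≢⇒< a≤s a≢s) s≤j+1)

parkingFunction-split⇒ : ∀ n s as → InRange (suc s) as → T (isParkingFunction n as) →
  let i = multiplicity (suc s) as in i ℕ.≤ n ∸ s × T (isParkingFunction (n ∸ i) (without (suc s) as))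
parkingFunction-split⇒ n s as range pf =
  i≤n-s , counts⇒parkingFunction (n ∸ i) bs (without-positive (suc s) as range) counts
  where
  i = multiplicity (suc s) as
  bs = without (suc s) as
  fits = parkingFunction⇒counts n as (inRange⇒positive as range) pf
  i≤n-s : i ℕ.≤ n ∸ s
  i≤n-s = subst (ℕ._≤ n ∸ s)
                (trans (carsAfter-split (suc s) s as ℕ.≤-refl) (cong (ℕ._+ i) (carsAfter-without (suc s) as range s ℕ.≤-refl)))
                (fits s)
  counts : ∀ j → carsAfter j bs ℕ.≤ n ∸ i ∸ j
  counts j with s ℕ.≤? j
  ... | yes s≤j = subst (ℕ._≤ n ∸ i ∸ j) (sym (carsAfter-without (suc s) as range j (s≤s s≤j))) z≤n
  ... | no  s≰j = subst (carsAfter j bs ℕ.≤_) (∸-comm n j i)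
                    (ℕ.m+n≤o⇒m≤o∸n (carsAfter j bs) (subst (ℕ._≤ n ∸ j) (carsAfter-split (suc s) j as j<s+1) (fits j)))
    where j<s+1 = s≤s (ℕ.<⇒≤ (ℕ.≰⇒> s≰j))

parkingFunction-split⇐ : ∀ n s as → InRange (suc s) as →
  let i = multiplicity (suc s) as in i ℕ.≤ n ∸ s → T (isParkingFunction (n ∸ i) (without (suc s) as)) →
  T (isParkingFunction n as)
parkingFunction-split⇐ n s as range i≤n-s pf = counts⇒parkingFunction n as (inRange⇒positive as range) counts
  where
  i = multiplicity (suc s) as
  bs = without (suc s) as
  fits = parkingFunction⇒counts (n ∸ i) bs (without-positive (suc s) as range) pf
  counts : ∀ j → carsAfter j as ℕ.≤ n ∸ j
  counts j with suc s ℕ.≤? j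
  ... | yes s+1≤j = subst (ℕ._≤ n ∸ j) (sym (carsAfter-beyond (suc s) as range j s+1≤j)) z≤n
  ... | no  s+1≰j = subst (ℕ._≤ n ∸ j) (sym (carsAfter-split (suc s) j as j<s+1)) (begin
    carsAfter j bs ℕ.+ i ≤⟨ ℕ.+-monoˡ-≤ i (subst (carsAfter j bs ℕ.≤_) (∸-comm n i j) (fits j)) ⟩
    n ∸ j ∸ i ℕ.+ i      ≡⟨ ℕ.m∸n+n≡m i≤n-j ⟩
    n ∸ j ∎)
    where
    open ℕ.≤-Reasoning
    j<s+1 = ℕ.≰⇒> s+1≰j
    i≤n-j : i ℕ.≤ n ∸ j
    i≤n-j = ℕ.≤-trans i≤n-s (ℕ.∸-monoʳ-≤ n (ℕ.≤-pred j<s+1))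

parkingFunction-split : ∀ n s as → InRange (suc s) as →
  isParkingFunction n as
  ≡ (multiplicity (suc s) as ≤ᵇ n ∸ s) ∧ isParkingFunction (n ∸ multiplicity (suc s) as) (without (suc s) as)
parkingFunction-split n s as range = T-extensional
  (λ pf → let (i≤ , pf′) = parkingFunction-split⇒ n s as range pf in Equivalence.from T-∧ (ℕ.≤⇒≤ᵇ i≤ , pf′))
  (λ ok → let (i≤ , pf′) = Equivalence.to T-∧ ok in parkingFunction-split⇐ n s as range (ℕ.≤ᵇ⇒≤ _ _ i≤) pf′)

-- The recurrence for p_{n;≤s}, by counting parking functions by their entries s + 1.

countTrue-++ : ∀ {A : Set} (p : A → Bool) xs ys → countTrue p (xs ++ ys) ≡ countTrue p xs ℕ.+ countTrue p ys
countTrue-++ p []       ys = refl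
countTrue-++ p (x ∷ xs) ys with p x
... | true  = cong suc (countTrue-++ p xs ys)
... | false = countTrue-++ p xs ys

countTrue-map : ∀ {A B : Set} (p : B → Bool) (f : A → B) xs → countTrue p (map f xs) ≡ countTrue (λ x → p (f x)) xs
countTrue-map p f []       = refl
countTrue-map p f (x ∷ xs) with p (f x)
... | true  = cong suc (countTrue-map p f xs)
... | false = countTrue-map p f xs

countTrue-cong : ∀ {A : Set} {p q : A → Bool} xs → All (λ x → p x ≡ q x) xs → countTrue p xs ≡ countTrue q xs
countTrue-cong []       []         = refl
countTrue-cong {q = q} (x ∷ xs) (px≡qx ∷ eqs) rewrite px≡qx with q x
... | true  = cong suc (countTrue-cong xs eqs)
... | false = countTrue-cong xs eqs

countTrue-∧ : ∀ {A : Set} (b : Bool) (p : A → Bool) xs →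
              + countTrue (λ x → b ∧ p x) xs ≡ (if b then + countTrue p xs else 0ℤ)
countTrue-∧ true  p xs = refl
countTrue-∧ false p []       = refl
countTrue-∧ false p (x ∷ xs) = countTrue-∧ false p xs

seqs-suc : ∀ (p : List ℕ → Bool) m s →
           + countTrue p (seqs (suc m) s) ≡ ∑[ a < s ] (+ countTrue (λ as → p (suc a ∷ as)) (seqs m s))
seqs-suc p m s = by-first suc s
  where
  by-first : ∀ (g : ℕ → ℕ) k →
             + countTrue p (concatMap (λ a → map (a ∷_) (seqs m s)) (applyUpTo g k))
             ≡ ∑[ a < k ] (+ countTrue (λ as → p (g a ∷ as)) (seqs m s))
  by-first g zero    = refl
  by-first g (suc k) = begin
    + countTrue p (first ++ rest)
      ≡⟨ cong +_ (countTrue-++ p first rest) ⟩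
    + (countTrue p first ℕ.+ countTrue p rest)
      ≡⟨ ℤ.pos-+ (countTrue p first) (countTrue p rest) ⟩
    + countTrue p first + + countTrue p rest
      ≡⟨ cong₂ _+_ (cong +_ (countTrue-map p (g 0 ∷_) (seqs m s))) (by-first (λ i → g (suc i)) k) ⟩
    ∑[ a < suc k ] (+ countTrue (λ as → p (g a ∷ as)) (seqs m s)) ∎
    where
    open ≡-Reasoning
    first = map (g 0 ∷_) (seqs m s)
    rest  = concatMap (λ a → map (a ∷_) (seqs m s)) (applyUpTo (λ i → g (suc i)) k)

seqs-inRange : ∀ n s → All (InRange s) (seqs n s)
seqs-inRange zero    s = [] ∷ []
seqs-inRange (suc n) s =
  concat⁺ (map⁺ (applyUpTo⁺₁ suc s (λ a<s → map⁺ (All.map (λ range → (s≤s z≤n , a<s) ∷ range) (seqs-inRange n s)))))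

count-first-entries : ∀ s n (G : List ℕ → ℕ → Bool) →
  ∑[ i < suc n ] (+ (n C i) * + countTrue (λ bs → G bs i) (seqs (suc n ∸ i) s))
  ≡ ∑[ a < s ] ∑[ i < suc n ] (+ (n C i) * + countTrue (λ bs → G (suc a ∷ bs) i) (seqs (n ∸ i) s))
count-first-entries s n G = begin
  ∑[ i < suc n ] (+ (n C i) * Count (suc n ∸ i) (λ bs → G bs i))
    ≡⟨ ∑-cong (suc n) (λ i i≤n → cong (+ (n C i) *_)
         (trans (cong (λ m → Count m (λ bs → G bs i)) (ℕ.+-∸-assoc 1 (ℕ.≤-pred i≤n))) (seqs-suc (λ bs → G bs i) (n ∸ i) s))) ⟩
  ∑[ i < suc n ] (+ (n C i) * ∑[ a < s ] Count (n ∸ i) (λ bs → G (suc a ∷ bs) i))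
    ≡⟨ ∑-cong (suc n) (λ i _ → sym (∑-*ˡ s (+ (n C i)) (λ a → Count (n ∸ i) (λ bs → G (suc a ∷ bs) i)))) ⟩
  ∑[ i < suc n ] ∑[ a < s ] (+ (n C i) * Count (n ∸ i) (λ bs → G (suc a ∷ bs) i))
    ≡⟨ ∑-swap (suc n) s (λ i a → + (n C i) * Count (n ∸ i) (λ bs → G (suc a ∷ bs) i)) ⟩
  ∑[ a < s ] ∑[ i < suc n ] (+ (n C i) * Count (n ∸ i) (λ bs → G (suc a ∷ bs) i)) ∎
  where
  open ≡-Reasoning
  Count : ℕ → (List ℕ → Bool) → ℤ
  Count m p = + countTrue p (seqs m s)

-- Classifying the sequences in {1,…,s+1}^n by the positions of their entries s + 1:
-- for every statistic G of (remaining entries, number of entries s + 1),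
--   #{as | G (without as) (mult as)} = Σ_i C(n,i) #{bs ∈ {1,…,s}^(n-i) | G bs i}.
count-by-multiplicity : ∀ s n (G : List ℕ → ℕ → Bool) →
  + countTrue (λ as → G (without (suc s) as) (multiplicity (suc s) as)) (seqs n (suc s))
  ≡ ∑[ i < suc n ] (+ (n C i) * + countTrue (λ bs → G bs i) (seqs (n ∸ i) s))
count-by-multiplicity s zero    G = sym (trans (ℤ.+-identityʳ _) (ℤ.*-identityˡ _))
count-by-multiplicity s (suc n) G = begin
  Multiples (suc n) G
    ≡⟨ seqs-suc _ n (suc s) ⟩
  ∑[ a < suc s ] (+ countTrue (λ as → G (without (suc s) (suc a ∷ as)) (multiplicity (suc s) (suc a ∷ as))) (seqs n (suc s)))
    ≡⟨ ∑-last s _ ⟩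
  ∑[ a < s ] (+ countTrue (λ as → G (without (suc s) (suc a ∷ as)) (multiplicity (suc s) (suc a ∷ as))) (seqs n (suc s)))
    + + countTrue (λ as → G (without (suc s) (suc s ∷ as)) (multiplicity (suc s) (suc s ∷ as))) (seqs n (suc s))
    ≡⟨ cong₂ _+_ (∑-cong s (λ a a<s → cong +_ (countTrue-cong (seqs n (suc s)) (All.universal (other-first a a<s) _))))
                 (cong +_ (countTrue-cong (seqs n (suc s)) (All.universal top-first _))) ⟩
  ∑[ a < s ] Multiples n (λ bs i → G (suc a ∷ bs) i) + Multiples n (λ bs i → G bs (suc i))
    ≡⟨ cong₂ _+_ (∑-cong s (λ a _ → count-by-multiplicity s n (λ bs i → G (suc a ∷ bs) i)))
                 (count-by-multiplicity s n (λ bs i → G bs (suc i))) ⟩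
  ∑[ a < s ] ∑[ i < suc n ] (+ (n C i) * Count (n ∸ i) (λ bs → G (suc a ∷ bs) i))
    + ∑[ i < suc n ] (+ (n C i) * Count (n ∸ i) (λ bs → G bs (suc i)))
    ≡⟨ cong (_+ ∑[ i < suc n ] (+ (n C i) * Count (n ∸ i) (λ bs → G bs (suc i)))) (count-first-entries s n G) ⟨
  ∑[ i < suc n ] (+ (n C i) * Count (suc n ∸ i) (λ bs → G bs i))
    + ∑[ i < suc n ] (+ (n C i) * Count (n ∸ i) (λ bs → G bs (suc i)))
    ≡⟨ pascal-∑ n (λ i → Count (suc n ∸ i) (λ bs → G bs i)) ⟨
  ∑[ i < suc (suc n) ] (+ (suc n C i) * Count (suc n ∸ i) (λ bs → G bs i)) ∎
  where
  open ≡-Reasoning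
  Multiples : ℕ → (List ℕ → ℕ → Bool) → ℤ
  Multiples m H = + countTrue (λ as → H (without (suc s) as) (multiplicity (suc s) as)) (seqs m (suc s))
  Count : ℕ → (List ℕ → Bool) → ℤ
  Count m p = + countTrue p (seqs m s)
  other-first : ∀ a → a ℕ.< s → ∀ as →
    G (without (suc s) (suc a ∷ as)) (multiplicity (suc s) (suc a ∷ as)) ≡ G (suc a ∷ without (suc s) as) (multiplicity (suc s) as)
  other-first a a<s as rewrite ≡ᵇ-false {a} {s} (λ a≡s → ℕ.<-irrefl a≡s a<s) = refl
  top-first : ∀ as → G (without (suc s) (suc s ∷ as)) (multiplicity (suc s) (suc s ∷ as))
                     ≡ G (without (suc s) as) (suc (multiplicity (suc s) as))
  top-first as rewrite ≡ᵇ-refl s = refl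

-- p_{n;≤s+1} = Σ_i C(n,i) [i ≤ n - s] p_{n-i;≤s}   (i = number of cars preferring s + 1)
pLe-rec : ∀ n s → + pLe n (suc s) ≡ ∑[ i < suc n ] (+ (n C i) * (if i ≤ᵇ n ∸ s then + pLe (n ∸ i) s else 0ℤ))
pLe-rec n s = begin
  + pLe n (suc s)
    ≡⟨ cong +_ (countTrue-cong (seqs n (suc s)) (All.map (λ {as} → parkingFunction-split n s as) (seqs-inRange n (suc s)))) ⟩
  + countTrue (λ as → G (without (suc s) as) (multiplicity (suc s) as)) (seqs n (suc s))
    ≡⟨ count-by-multiplicity s n G ⟩
  ∑[ i < suc n ] (+ (n C i) * + countTrue (λ bs → G bs i) (seqs (n ∸ i) s))
    ≡⟨ ∑-cong (suc n) (λ i _ → cong (+ (n C i) *_) (countTrue-∧ (i ≤ᵇ n ∸ s) (isParkingFunction (n ∸ i)) (seqs (n ∸ i) s))) ⟩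
  ∑[ i < suc n ] (+ (n C i) * (if i ≤ᵇ n ∸ s then + pLe (n ∸ i) s else 0ℤ)) ∎
  where
  open ≡-Reasoning
  G : List ℕ → ℕ → Bool
  G bs i = (i ≤ᵇ n ∸ s) ∧ isParkingFunction (n ∸ i) bs

-- n! times the coefficient of x^n in R_k(x).
R-coeff : ℕ → ℕ → ℤ
R-coeff n k = if k ≤ᵇ n then + pLe n (n ∸ k) else 0ℤ

-- Below the diagonal, R_k satisfies the recurrence of the theorem (with the term i = 0 included).
R-coeff-rec : ∀ n k → suc k ℕ.≤ n → R-coeff n k ≡ ∑[ i < suc (suc k) ] (+ (n C i) * R-coeff (n ∸ i) (suc k ∸ i))
R-coeff-rec n k k<n = begin
  R-coeff n k
    ≡⟨ if-≤ᵇ-true (ℕ.<⇒≤ k<n) ⟩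
  + pLe n (n ∸ k)
    ≡⟨ cong (λ t → + pLe n t) (ℕ.+-∸-assoc 1 k<n) ⟩
  + pLe n (suc s)
    ≡⟨ pLe-rec n s ⟩
  ∑[ i < suc n ] F i
    ≡⟨ ∑-extend F (s≤s k<n) (λ i k+1<i _ → trans (cong (+ (n C i) *_) (if-≤ᵇ-false (λ i≤ → ℕ.<⇒≱ k+1<i (subst (i ℕ.≤_) n-s i≤))))
                                                  (ℤ.*-zeroʳ (+ (n C i)))) ⟩
  ∑[ i < suc (suc k) ] F i
    ≡⟨ ∑-cong (suc (suc k)) (λ i i≤k+1 → cong (+ (n C i) *_) (term i (ℕ.≤-pred i≤k+1))) ⟩
  ∑[ i < suc (suc k) ] (+ (n C i) * R-coeff (n ∸ i) (suc k ∸ i)) ∎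
  where
  open ≡-Reasoning
  s = n ∸ suc k
  n-s : n ∸ s ≡ suc k
  n-s = ℕ.m∸[m∸n]≡n k<n
  F : ℕ → ℤ
  F i = + (n C i) * (if i ≤ᵇ n ∸ s then + pLe (n ∸ i) s else 0ℤ)
  term : ∀ i → i ℕ.≤ suc k → (if i ≤ᵇ n ∸ s then + pLe (n ∸ i) s else 0ℤ) ≡ R-coeff (n ∸ i) (suc k ∸ i)
  term i i≤k+1 = begin
    (if i ≤ᵇ n ∸ s then + pLe (n ∸ i) s else 0ℤ)
      ≡⟨ if-≤ᵇ-true (subst (i ℕ.≤_) (sym n-s) i≤k+1) ⟩
    + pLe (n ∸ i) s
      ≡⟨ cong (λ t → + pLe (n ∸ i) t) (trans (ℕ.∸-+-assoc n i (suc k ∸ i)) (cong (n ∸_) (ℕ.m+[n∸m]≡n i≤k+1))) ⟨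
    + pLe (n ∸ i) (n ∸ i ∸ (suc k ∸ i))
      ≡⟨ if-≤ᵇ-true (ℕ.∸-monoˡ-≤ i k<n) ⟨
    R-coeff (n ∸ i) (suc k ∸ i) ∎

-- On and above the diagonal: p_{n;≤0} = [n = 0].
R-coeff-boundary : ∀ n k → n ℕ.≤ k → R-coeff n k ≡ δ n k
R-coeff-boundary n k n≤k with ℕ.m≤n⇒m<n∨m≡n n≤k
... | inj₁ n<k  = trans (if-≤ᵇ-false (ℕ.<⇒≱ n<k)) (sym (δ-off-diagonal n<k))
... | inj₂ refl = trans (if-≤ᵇ-true (ℕ.≤-refl {n})) (trans (cong (λ t → + pLe n t) (ℕ.n∸n≡0 n)) (diagonal n))
  where diagonal : ∀ n → + pLe n 0 ≡ δ n n
        diagonal zero    = refl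
        diagonal (suc n) = refl

-- R_k agrees with the closed form: both have the same boundary values and satisfy
-- the same recurrence, which determines all values below the diagonal.
R-coeff≡closedForm : ∀ n k → R-coeff n k ≡ closedForm n k
R-coeff≡closedForm = <-rec (λ n → ∀ k → R-coeff n k ≡ closedForm n k)
                           (λ n IH k → descend n IH n k (ℕ.m≤n+m n k))
  where
  -- for fixed n (all shorter lengths being settled) induct on the distance to the diagonal
  descend : ∀ n → (∀ {m} → m ℕ.< n → ∀ k → R-coeff m k ≡ closedForm m k) →
            ∀ d k → n ℕ.≤ k ℕ.+ d → R-coeff n k ≡ closedForm n k
  descend n IH d k n≤k+d with n ℕ.≤? k
  ... | yes n≤k = trans (R-coeff-boundary n k n≤k) (sym (closedForm-boundary n k n≤k))
  descend n IH zero    k n≤k+0 | no n≰k = ⊥-elim (n≰k (subst (n ℕ.≤_) (ℕ.+-identityʳ k) n≤k+0))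
  descend n IH (suc d) k n≤k+d | no n≰k = begin
    R-coeff n k
      ≡⟨ R-coeff-rec n k k<n ⟩
    ∑[ i < suc (suc k) ] (+ (n C i) * R-coeff (n ∸ i) (suc k ∸ i))
      ≡⟨ cong₂ _+_ (cong (+ (n C 0) *_) (descend n IH d (suc k) (subst (n ℕ.≤_) (ℕ.+-suc k d) n≤k+d)))
                   (∑-cong (suc k) (λ i _ → cong (+ (n C suc i) *_) (IH (shorter i) (k ∸ i)))) ⟩
    ∑[ i < suc (suc k) ] (+ (n C i) * closedForm (n ∸ i) (suc k ∸ i))
      ≡⟨ closedForm-rec n k (inj₂ k<n) ⟩
    closedForm n k ∎
    where
    open ≡-Reasoning
    k<n = ℕ.≰⇒> n≰k
    shorter : ∀ i → n ∸ suc i ℕ.< n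
    shorter i = ℕ.≤-<-trans (ℕ.∸-monoʳ-≤ n (s≤s (z≤n {i}))) (ℕ.∸-monoʳ-< (s≤s z≤n) (ℕ.≤-trans (s≤s z≤n) k<n))

-- Exponential generating functions: the series z_n/n! of Defs.

-- Fractions are compared in ℚᵘ, where z / d is just the pair (z, d).
private
  toℚᵘ-/ : ∀ z d .{{_ : ℕ.NonZero d}} → toℚᵘ (z / d) ≃ᵘ (z ℚᵘ./ d)
  toℚᵘ-/ z (suc d) = ℚ.toℚᵘ-fromℚᵘ (mkℚᵘ z d)

/-≡ : ∀ a b d e .{{_ : ℕ.NonZero d}} .{{_ : ℕ.NonZero e}} → a * + e ≡ b * + d → a / d ≡ b / e
/-≡ a b d@(suc _) e@(suc _) eq = ℚ.toℚᵘ-injective (ℚᵘ.≃-trans (toℚᵘ-/ a d) (ℚᵘ.≃-trans (*≡* eq) (ℚᵘ.≃-sym (toℚᵘ-/ b e))))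

/-+ : ∀ a b d .{{_ : ℕ.NonZero d}} → (a / d) ℚ.+ (b / d) ≡ (a + b) / d
/-+ a b d@(suc _) = ℚ.toℚᵘ-injective (begin
  toℚᵘ ((a / d) ℚ.+ (b / d))                ≈⟨ ℚ.toℚᵘ-homo-+ (a / d) (b / d) ⟩
  toℚᵘ (a / d) ℚᵘ.+ toℚᵘ (b / d)            ≈⟨ ℚᵘ.+-cong (toℚᵘ-/ a d) (toℚᵘ-/ b d) ⟩
  (a ℚᵘ./ d) ℚᵘ.+ (b ℚᵘ./ d)                ≈⟨ *≡* (trans (common-denominator a b (+ d)) (cong ((a + b) *_) (sym (ℤ.pos-* d d)))) ⟩
  (a + b) ℚᵘ./ d                            ≈⟨ ℚᵘ.≃-sym (toℚᵘ-/ (a + b) d) ⟩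
  toℚᵘ ((a + b) / d) ∎)
  where
  open ℚᵘ.≃-Reasoning
  common-denominator : ∀ a b D → (a * D + b * D) * D ≡ (a + b) * (D * D)
  common-denominator = solve-∀

neg-/ : ∀ a d .{{_ : ℕ.NonZero d}} → ℚ.- (a / d) ≡ (- a) / d
neg-/ a d@(suc _) = ℚ.toℚᵘ-injective (ℚᵘ.≃-trans (ℚ.toℚᵘ-homo‿- (a / d))
                              (ℚᵘ.≃-trans (ℚᵘ.-‿cong (toℚᵘ-/ a d)) (ℚᵘ.≃-sym (toℚᵘ-/ (- a) d))))

/-* : ∀ a b d e .{{_ : ℕ.NonZero d}} .{{_ : ℕ.NonZero e}} →
      (a / d) ℚ.* (b / e) ≡ ((a * b) / (d ℕ.* e)) {{ℕ.m*n≢0 d e}}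
/-* a b d@(suc _) e@(suc _) = ℚ.toℚᵘ-injective (begin
  toℚᵘ ((a / d) ℚ.* (b / e))       ≈⟨ ℚ.toℚᵘ-homo-* (a / d) (b / e) ⟩
  toℚᵘ (a / d) ℚᵘ.* toℚᵘ (b / e)   ≈⟨ ℚᵘ.*-cong (toℚᵘ-/ a d) (toℚᵘ-/ b e) ⟩
  (a * b) ℚᵘ./ (d ℕ.* e)           ≈⟨ ℚᵘ.≃-sym (toℚᵘ-/ (a * b) (d ℕ.* e)) ⟩
  toℚᵘ ((a * b) / (d ℕ.* e)) ∎)
  where open ℚᵘ.≃-Reasoning

/!-+ : ∀ a b n → (a /! n) ℚ.+ (b /! n) ≡ (a + b) /! n
/!-+ a b n = /-+ a b (n !) {{n ℕ.!≢0}}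

/!-- : ∀ a b n → (a /! n) ℚ.- (b /! n) ≡ (a - b) /! n
/!-- a b n = trans (cong ((a /! n) ℚ.+_) (neg-/ b (n !) {{n ℕ.!≢0}})) (/!-+ a (- b) n)

/!-zero : ∀ n → 0ℤ /! n ≡ 0ℚ
/!-zero n = ℚ.0/n≡0 (n !) {{n ℕ.!≢0}}

/!-* : ∀ a b {n j} → j ℕ.≤ n → (a /! j) ℚ.* (b /! (n ∸ j)) ≡ (+ (n C j) * (a * b)) /! n
/!-* a b {n} {j} j≤n = trans (/-* a b (j !) ((n ∸ j) !) {{j ℕ.!≢0}} {{(n ∸ j) ℕ.!≢0}})
  (/-≡ (a * b) (+ (n C j) * (a * b)) _ _ {{ℕ.m*n≢0 (j !) ((n ∸ j) !) {{j ℕ.!≢0}} {{(n ∸ j) ℕ.!≢0}}}} {{n ℕ.!≢0}} (begin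
    a * b * + (n !)                                 ≡⟨ cong (λ m → a * b * + m) (C-factorials j≤n) ⟨
    a * b * + ((n C j) ℕ.* (j ! ℕ.* (n ∸ j) !))     ≡⟨ cong (a * b *_) (ℤ.pos-* (n C j) _) ⟩
    a * b * (+ (n C j) * + (j ! ℕ.* (n ∸ j) !))     ≡⟨ shuffle (a * b) (+ (n C j)) _ ⟩
    + (n C j) * (a * b) * + (j ! ℕ.* (n ∸ j) !) ∎))
  where
  open ≡-Reasoning
  shuffle : ∀ x c d → x * (c * d) ≡ c * x * d
  shuffle = solve-∀

sumℚ-∑ : ∀ (G : ℕ → ℚ) (g : ℕ → ℕ) m → sumℚ (map G (applyUpTo g m)) ≡ ℚΣ.∑ m (λ i → G (g i))
sumℚ-∑ G g zero    = refl
sumℚ-∑ G g (suc m) = cong (G (g 0) ℚ.+_) (sumℚ-∑ G (λ i → g (suc i)) m)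

∑-/! : ∀ m (h : ℕ → ℤ) n → ℚΣ.∑ m (λ i → h i /! n) ≡ ∑ m h /! n
∑-/! zero    h n = sym (/!-zero n)
∑-/! (suc m) h n = trans (cong (h 0 /! n ℚ.+_) (∑-/! m (λ i → h (suc i)) n)) (/!-+ (h 0) _ n)

sumℚ-/! : ∀ (G : ℕ → ℚ) (g : ℕ → ℕ) m (h : ℕ → ℤ) n →
          (∀ i → i ℕ.< m → G (g i) ≡ h i /! n) → sumℚ (map G (applyUpTo g m)) ≡ ∑ m h /! n
sumℚ-/! G g m h n terms = trans (sumℚ-∑ G g m) (trans (ℚΣ.∑-cong m terms) (∑-/! m h n))

egf-product : ∀ {f g : Series} (u v : ℕ → ℤ) → (∀ j → f j ≡ u j /! j) → (∀ j → g j ≡ v j /! j) →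
              ∀ n → (f ⊛ g) n ≡ (∑[ j < suc n ] (+ (n C j) * (u j * v (n ∸ j)))) /! n
egf-product {f} {g} u v f-coeff g-coeff n =
  sumℚ-/! (λ j → f j ℚ.* g (n ∸ j)) (0 ℕ.+_) (suc n) (λ j → + (n C j) * (u j * v (n ∸ j))) n
  (λ j j≤n → trans (cong₂ ℚ._*_ (f-coeff j) (g-coeff (n ∸ j))) (/!-* (u j) (v (n ∸ j)) (ℕ.≤-pred j≤n)))

polynomial-coeff : ∀ (z : ℕ → ℤ) b m → ΣS 0 b (λ i → (z i /! i) · X^ i) m ≡ (if suc m ≤ᵇ b then z m else 0ℤ) /! m
polynomial-coeff z b m = trans (sumℚ-/! (λ i → (z i /! i) ℚ.* X^ i m) (0 ℕ.+_) b h m (λ i _ → monomial i))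
                               (cong (_/! m) collapse)
  where
  h : ℕ → ℤ
  h i = if m ≡ᵇ i then z m else 0ℤ
  monomial : ∀ i → (z i /! i) ℚ.* X^ i m ≡ h i /! m
  monomial i with m ≡ᵇ i in e
  ... | true  = trans (ℚ.*-identityʳ (z i /! i)) (cong (λ j → z j /! j) (sym (≡ᵇ-true {m} {i} e)))
  ... | false = trans (ℚ.*-zeroʳ (z i /! i)) (sym (/!-zero m))
  collapse : ∑ b h ≡ (if suc m ≤ᵇ b then z m else 0ℤ)
  collapse with suc m ℕ.≤? b
  ... | yes m<b = trans (∑-single b m h m<b (λ i _ i≢m → cong (λ t → if t then z m else 0ℤ) (≡ᵇ-false (λ m≡i → i≢m (sym m≡i)))))
                        (trans (cong (λ t → if t then z m else 0ℤ) (≡ᵇ-refl m)) (sym (if-≤ᵇ-true m<b)))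
  ... | no  m≮b = trans (∑-zero b (λ i i<b → cong (λ t → if t then z m else 0ℤ) (≡ᵇ-false (λ m≡i → m≮b (subst (ℕ._< b) (sym m≡i) i<b)))))
                        (sym (if-≤ᵇ-false m≮b))

X^-shift : ∀ i (F : Series) n → i ℕ.≤ n → (X^ i ⊛ F) n ≡ F (n ∸ i)
X^-shift i F n i≤n = begin
  (X^ i ⊛ F) n                          ≡⟨ sumℚ-∑ (λ j → X^ i j ℚ.* F (n ∸ j)) (0 ℕ.+_) (suc n) ⟩
  ℚΣ.∑ (suc n) (λ j → X^ i j ℚ.* F (n ∸ j)) ≡⟨ ℚΣ.∑-single (suc n) i _ (s≤s i≤n) (λ j _ → X^-off i j) ⟩
  X^ i i ℚ.* F (n ∸ i)                  ≡⟨ cong (λ b → (if b then 1ℚ else 0ℚ) ℚ.* F (n ∸ i)) (≡ᵇ-refl i) ⟩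
  1ℚ ℚ.* F (n ∸ i)                      ≡⟨ ℚ.*-identityˡ (F (n ∸ i)) ⟩
  F (n ∸ i) ∎
  where
  open ≡-Reasoning
  X^-off : ∀ i j → j ≢ i → X^ i j ℚ.* F (n ∸ j) ≡ 0ℚ
  X^-off i j j≢i = trans (cong (λ b → (if b then 1ℚ else 0ℚ) ℚ.* F (n ∸ j)) (≡ᵇ-false j≢i)) (ℚ.*-zeroˡ (F (n ∸ j)))

X^-vanish : ∀ i (F : Series) n → n ℕ.< i → (X^ i ⊛ F) n ≡ 0ℚ
X^-vanish i F n n<i = trans (sumℚ-∑ (λ j → X^ i j ℚ.* F (n ∸ j)) (0 ℕ.+_) (suc n))
  (ℚΣ.∑-zero (suc n) (λ j j≤n → trans (cong (λ b → (if b then 1ℚ else 0ℚ) ℚ.* F (n ∸ j))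
                                              (≡ᵇ-false (λ j≡i → ℕ.<⇒≱ n<i (subst (ℕ._≤ n) j≡i (ℕ.≤-pred j≤n)))))
                                       (ℚ.*-zeroˡ (F (n ∸ j)))))

shifted-coeff : ∀ i {F : Series} (v : ℕ → ℤ) → (∀ j → F j ≡ v j /! j) →
                ∀ n → (((+ 1) /! i) · (X^ i ⊛ F)) n ≡ (+ (n C i) * v (n ∸ i)) /! n
shifted-coeff i {F} v F-coeff n with i ℕ.≤? n
... | yes i≤n = begin
  ((+ 1) /! i) ℚ.* (X^ i ⊛ F) n           ≡⟨ cong (((+ 1) /! i) ℚ.*_) (trans (X^-shift i F n i≤n) (F-coeff (n ∸ i))) ⟩
  ((+ 1) /! i) ℚ.* (v (n ∸ i) /! (n ∸ i)) ≡⟨ /!-* (+ 1) (v (n ∸ i)) i≤n ⟩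
  (+ (n C i) * (+ 1 * v (n ∸ i))) /! n    ≡⟨ cong (λ t → (+ (n C i) * t) /! n) (ℤ.*-identityˡ (v (n ∸ i))) ⟩
  (+ (n C i) * v (n ∸ i)) /! n ∎
  where open ≡-Reasoning
... | no  i≰n = begin
  ((+ 1) /! i) ℚ.* (X^ i ⊛ F) n           ≡⟨ cong (((+ 1) /! i) ℚ.*_) (X^-vanish i F n (ℕ.≰⇒> i≰n)) ⟩
  ((+ 1) /! i) ℚ.* 0ℚ                     ≡⟨ ℚ.*-zeroʳ ((+ 1) /! i) ⟩
  0ℚ                                      ≡⟨ /!-zero n ⟨
  0ℤ /! n                                 ≡⟨ cong (_/! n) (trans (cong (λ c → + c * v (n ∸ i)) (k>n⇒nCk≡0 (ℕ.≰⇒> i≰n))) (ℤ.*-zeroˡ (v (n ∸ i)))) ⟨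
  (+ (n C i) * v (n ∸ i)) /! n ∎
  where open ≡-Reasoning

R-coeffs : ∀ k n → R k n ≡ R-coeff n k /! n
R-coeffs k n with k ≤ᵇ n
... | true  = refl
... | false = sym (/!-zero n)

R-closedForm : ∀ k n → R k n ≡ closedForm n k /! n
R-closedForm k n = trans (R-coeffs k n) (cong (_/! n) (R-coeff≡closedForm n k))

A-series B-series : ℕ → Series
A-series k = ΣS 0 (suc k) (λ i → (signedPow i (suc k ∸ i) /! i) · X^ i)
B-series k = ΣS 0 k (λ i → (signedPow i (k ∸ i) /! i) · X^ i)

A-series-coeff : ∀ k m → A-series k m ≡ A-coeff k m /! m
A-series-coeff k m = trans (polynomial-coeff (λ i → signedPow i (suc k ∸ i)) (suc k) m) (cong (_/! m) degree)
  where
  degree : (if suc m ≤ᵇ suc k then A-coeff k m else 0ℤ) ≡ A-coeff k m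
  degree with m ℕ.≤? k
  ... | yes m≤k = if-≤ᵇ-true (s≤s m≤k)
  ... | no  m≰k = trans (if-≤ᵇ-false (λ m<k+1 → m≰k (ℕ.≤-pred m<k+1)))
                        (sym (A-coeff-above (ℕ.≰⇒> m≰k)))

B-series-coeff : ∀ k m → B-series k m ≡ B-coeff k m /! m
B-series-coeff k m = polynomial-coeff (λ i → signedPow i (k ∸ i)) k m

PA-series-coeff : ∀ k n → (P ⊛ A-series k) n ≡ PA-coeff n k /! n
PA-series-coeff k n = egf-product cayley (A-coeff k) (λ _ → refl) (A-series-coeff k) n

R-closed : ∀ k → R k ≗ ((P ⊛ A-series k) ⊖ B-series k)
R-closed k n = begin
  R k n                                         ≡⟨ R-closedForm k n ⟩
  (PA-coeff n k - B-coeff k n) /! n             ≡⟨ /!-- (PA-coeff n k) (B-coeff k n) n ⟨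
  PA-coeff n k /! n ℚ.- B-coeff k n /! n        ≡⟨ cong₂ ℚ._-_ (PA-series-coeff k n) (B-series-coeff k n) ⟨
  (P ⊛ A-series k) n ℚ.- B-series k n ∎
  where open ≡-Reasoning

-- R_0 = P, since P A_0 = P and B_0 = 0.
R₀ : R 0 ≗ P
R₀ n = trans (R-closedForm 0 n) (cong (_/! n) (closedForm-zero n))

-- R_1 = (1 - x) P - 1: the case k = 1 of the closed form, with A_1 = 1 - x and B_1 = 1.
one-minus-x-coeff : ∀ j → (one ⊖ X^ 1) j ≡ A-coeff 1 j /! j
one-minus-x-coeff zero          = refl
one-minus-x-coeff (suc zero)    = refl
one-minus-x-coeff (suc (suc j)) = trans (sym (/!-zero (suc (suc j))))
                                        (cong (_/! suc (suc j)) (sym (A-coeff-above {1} {suc (suc j)} (s≤s (s≤s z≤n)))))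

B₁≗one : B-series 1 ≗ one
B₁≗one zero    = refl
B₁≗one (suc n) = trans (B-series-coeff 1 (suc n)) (/!-zero (suc n))

R₁ : R 1 ≗ (((one ⊖ X^ 1) ⊛ P) ⊖ one)
R₁ n = begin
  R 1 n                                                          ≡⟨ R-closed 1 n ⟩
  (P ⊛ A-series 1) n ℚ.- B-series 1 n                            ≡⟨ cong₂ ℚ._-_ P⊛A₁ (B₁≗one n) ⟩
  ((one ⊖ X^ 1) ⊛ P) n ℚ.- one n ∎
  where
  open ≡-Reasoning
  P⊛A₁ : (P ⊛ A-series 1) n ≡ ((one ⊖ X^ 1) ⊛ P) n
  P⊛A₁ = begin
    (P ⊛ A-series 1) n                                              ≡⟨ PA-series-coeff 1 n ⟩
    PA-coeff n 1 /! n                                               ≡⟨ cong (_/! n) (binomial-convolution-comm n cayley (A-coeff 1)) ⟩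
    (∑[ j < suc n ] (+ (n C j) * (A-coeff 1 j * cayley (n ∸ j)))) /! n ≡⟨ egf-product (A-coeff 1) cayley one-minus-x-coeff (λ _ → refl) n ⟨
    ((one ⊖ X^ 1) ⊛ P) n ∎

closedForm-step : ∀ n k → 1 ≤ k →
  closedForm n (suc k) ≡ closedForm n k - ∑[ i < suc k ] (+ (n C suc i) * closedForm (n ∸ suc i) (k ∸ i))
closedForm-step n k 1≤k = begin
  closedForm n (suc k)                    ≡⟨ isolate (closedForm n (suc k)) S ⟩
  (1ℤ * closedForm n (suc k) + S) - S     ≡⟨ cong (_- S) (closedForm-rec n k (inj₁ 1≤k)) ⟩
  closedForm n k - S ∎
  where
  open ≡-Reasoning
  S = ∑[ i < suc k ] (+ (n C suc i) * closedForm (n ∸ suc i) (k ∸ i))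
  isolate : ∀ a b → a ≡ (1ℤ * a + b) - b
  isolate = solve-∀

R-rec : ∀ k → 1 ≤ k → R (suc k) ≗ (R k ⊖ ΣS 1 (suc (suc k)) (λ i → ((+ 1) /! i) · (X^ i ⊛ R (suc k ∸ i))))
R-rec k 1≤k n = begin
  R (suc k) n                         ≡⟨ R-closedForm (suc k) n ⟩
  closedForm n (suc k) /! n           ≡⟨ cong (_/! n) (closedForm-step n k 1≤k) ⟩
  (closedForm n k - S) /! n           ≡⟨ /!-- (closedForm n k) S n ⟨
  closedForm n k /! n ℚ.- S /! n      ≡⟨ cong₂ ℚ._-_ (R-closedForm k n) shifted ⟨
  R k n ℚ.- ΣS 1 (suc (suc k)) (λ i → ((+ 1) /! i) · (X^ i ⊛ R (suc k ∸ i))) n ∎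
  where
  open ≡-Reasoning
  S = ∑[ i < suc k ] (+ (n C suc i) * closedForm (n ∸ suc i) (k ∸ i))
  shifted : ΣS 1 (suc (suc k)) (λ i → ((+ 1) /! i) · (X^ i ⊛ R (suc k ∸ i))) n ≡ S /! n
  shifted = sumℚ-/! (λ i → (((+ 1) /! i) · (X^ i ⊛ R (suc k ∸ i))) n) (1 ℕ.+_) (suc k)
                    (λ i → + (n C suc i) * closedForm (n ∸ suc i) (k ∸ i)) n
                    (λ i _ → shifted-coeff (suc i) (λ m → closedForm m (k ∸ i)) (R-closedForm (k ∸ i)) n)

theorem3p2 :
    (R 0 ≗ P)
    × (R 1 ≗ (((one ⊖ X^ 1) ⊛ P) ⊖ one))
    × (∀ (k : ℕ) → 1 ≤ k →
         R (suc k) ≗ (R k ⊖ ΣS 1 (suc (suc k)) (λ i → ((+ 1) /! i) · (X^ i ⊛ R (suc k ∸ i)))))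
    × (∀ (k : ℕ) →
         R k ≗ ((P ⊛ ΣS 0 (suc k) (λ i → (signedPow i (suc k ∸ i) /! i) · X^ i))
                ⊖ ΣS 0 k (λ i → (signedPow i (k ∸ i) /! i) · X^ i)))
theorem3p2 = R₀ , R₁ , R-rec , R-closed
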